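{- For $\omega\in\mathcal{OF}_n$ and $\omega_1,\dots,\omega_n\in\widehat{Lie(\mathcal{PT})}$, the expression $\omega_1\cdots\omega_n\circ\omega$ evaluates to the sum of all possible forests obtained by replacing vertex $i$ in $\omega$ by the forest $\omega_i$ (viewed in $\mathcal{OF}$), for all $i=1,\dots,n$, where the incoming edge to vertex $i$ becomes one incoming edge to each of the roots of $\omega_i$, the edges outgoing from vertex $i$ become outgoing from any vertex of $\omega_i$, and the left to right ordering of edges outgoing from the same vertex $i$ is preserved whenever the edges end up on the same vertex in $\omega_i$.
   Context: Planar rooted trees $\mathcal{PT}$, ordered forests $\mathcal{OF}$ with concatenation. Left grafting $\tau_1\rhd\tau_2$: sum over ways of adding an edge from a vertex of $\tau_2$ to the root of $\tau_1$, leftmost at that vertex; extended to $\mathcal{OF}$ by $\tau_1\rhd\tau_2\omega_2=(\tau_1\rhd\tau_2)\omega_2+\tau_2(\tau_1\rhd\omega_2)$, $\tau_1\omega_1\rhd\omega_2=\tau_1\rhd(\omega_1\rhd\omega_2)-(\tau_1\rhd\omega_1)\rhd\omega_2$. $Lie(\mathcal{PT})\subset\mathcal{OF}$: Lie polynomials generated by $\mathcal{PT}$ under $[x,y]=xy-yx$, an element of $Lie(\mathcal{PT})$ thus being a linear combination of forests. $Lie(\mathcal{PT})_n$ (resp. $\mathcal{OF}_n$): Lie brackets of planar trees (resp. ordered forests) with $n$ vertices labelled by $\{1,\dots,n\}$; $\widehat{Lie(\mathcal{PT})}=\bigoplus_n Lie(\mathcal{PT})_n$. For $\omega\in\mathcal{OF}_n$,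 $\omega_1\cdots\omega_n\circ\omega$ is obtained by expressing $\omega$ in terms of its labelled single-vertex trees, concatenation and $\rhd$, and replacing the single vertex labelled $i$ by $\omega_i$, then evaluating. -}

module Defs where

open import Data.Nat using (ℕ; zero; suc)
open import Data.Integer using (ℤ; -_; _*_; 1ℤ; 0ℤ) renaming (_+_ to _+ℤ_)
open import Data.Fin using (Fin)
open import Data.List using (List; []; _∷_; _++_; map; concatMap; length; allFin; upTo)
open import Data.List.Relation.Binary.Permutation.Propositional using (_↭_)
open import Data.Product using (_×_; _,_; proj₁; proj₂)
open import Relation.Binary.Definitions using (DecidableEquality)
open import Relation.Binary.PropositionalEquality using (_≡_; refl; cong; cong₂)
open import Relation.Nullary using (yes; no)

data Tree (A : Set) : Set where
  node : A → List (Tree A) → Tree A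

Forest : Set → Set
Forest A = List (Tree A)

mutual
  labelsT : {A : Set} → Tree A → List A
  labelsT (node a cs) = a ∷ labelsF cs

  labelsF : {A : Set} → Forest A → List A
  labelsF [] = []
  labelsF (t ∷ ts) = labelsT t ++ labelsF ts

mutual
  relabelT : {A B : Set} → (A → B) → Tree A → Tree B
  relabelT f (node a cs) = node (f a) (relabelF f cs)

  relabelF : {A B : Set} → (A → B) → Forest A → Forest B
  relabelF f [] = []
  relabelF f (t ∷ ts) = relabelT f t ∷ relabelF f ts

module _ {A : Set} (_≟A_ : DecidableEquality A) where
  private
    node-inj₁ : ∀ {a b : A} {cs ds} → node a cs ≡ node b ds → a ≡ b
    node-inj₁ refl = refl
    node-inj₂ : ∀ {a b : A} {cs ds} → node a cs ≡ node b ds → cs ≡ ds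
    node-inj₂ refl = refl
    ∷-inj₁ : ∀ {x y : Tree A} {xs ys} → _≡_ {A = List (Tree A)} (x ∷ xs) (y ∷ ys) → x ≡ y
    ∷-inj₁ refl = refl
    ∷-inj₂ : ∀ {x y : Tree A} {xs ys} → _≡_ {A = List (Tree A)} (x ∷ xs) (y ∷ ys) → xs ≡ ys
    ∷-inj₂ refl = refl

  mutual
    decTree : DecidableEquality (Tree A)
    decTree (node a cs) (node b ds) with a ≟A b | decForest cs ds
    ... | yes refl | yes refl = yes refl
    ... | no ¬p | _ = no (λ e → ¬p (node-inj₁ e))
    ... | yes _ | no ¬q = no (λ e → ¬q (node-inj₂ e))

    decForest : DecidableEquality (Forest A)
    decForest [] [] = yes refl
    decForest [] (_ ∷ _) = no (λ ())
    decForest (_ ∷ _) [] = no (λ ())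
    decForest (x ∷ xs) (y ∷ ys) with decTree x y | decForest xs ys
    ... | yes refl | yes refl = yes refl
    ... | no ¬p | _ = no (λ e → ¬p (∷-inj₁ e))
    ... | yes _ | no ¬q = no (λ e → ¬q (∷-inj₂ e))

Lin : Set → Set
Lin X = List (ℤ × X)

neg : {X : Set} → Lin X → Lin X
neg = map (λ p → (- proj₁ p , proj₂ p))

scale : {X : Set} → ℤ → Lin X → Lin X
scale c = map (λ p → (c * proj₁ p , proj₂ p))

basis : {X : Set} → List X → Lin X
basis = map (λ x → (1ℤ , x))

linmap : {X Y : Set} → (X → Lin Y) → Lin X → Lin Y
linmap f = concatMap (λ p → scale (proj₁ p) (f (proj₂ p)))

bilin : {X Y Z : Set} → (X → Y → Lin Z) → Lin X → Lin Y → Lin Z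
bilin f L M = linmap (λ x → linmap (λ y → f x y) M) L

coeff : {X : Set} → DecidableEquality X → X → Lin X → ℤ
coeff _≟_ x [] = 0ℤ
coeff _≟_ x ((c , y) ∷ L) with y ≟ x
... | yes _ = c +ℤ coeff _≟_ x L
... | no _ = coeff _≟_ x L

LinEq : {A : Set} → DecidableEquality A → Lin (Forest A) → Lin (Forest A) → Set
LinEq {A} _≟_ L M = (f : Forest A) → coeff (decForest _≟_) f L ≡ coeff (decForest _≟_) f M

concatL : {A : Set} → Lin (Forest A) → Lin (Forest A) → Lin (Forest A)
concatL = bilin (λ x y → (1ℤ , x ++ y) ∷ [])

mutual
  graftT : {A : Set} → Tree A → Tree A → List (Tree A)
  graftT s (node a cs) = node a (s ∷ cs) ∷ map (node a) (graftF s cs)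

  graftF : {A : Set} → Tree A → Forest A → List (Forest A)
  graftF s [] = []
  graftF s (t ∷ ts) = map (_∷ ts) (graftT s t) ++ map (t ∷_) (graftF s ts)

treeOnto : {A : Set} → Tree A → Forest A → Lin (Forest A)
treeOnto s ω = basis (graftF s ω)

-- forest onto forest:  1 ▷ ω = ω,
-- τ ω₁ ▷ ω₂ = τ ▷ (ω₁ ▷ ω₂) − (τ ▷ ω₁) ▷ ω₂
-- (the fuel is the length of the left forest; grafting preserves length)
graftFuel : {A : Set} → ℕ → Forest A → Forest A → Lin (Forest A)
graftFuel _ [] ω₂ = (1ℤ , ω₂) ∷ []
graftFuel zero (_ ∷ _) _ = []
graftFuel (suc k) (τ ∷ ω₁) ω₂ =
  linmap (treeOnto τ) (graftFuel k ω₁ ω₂)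
  ++ neg (linmap (λ ω → graftFuel k ω ω₂) (treeOnto τ ω₁))

_▷_ : {A : Set} → Forest A → Forest A → Lin (Forest A)
ω₁ ▷ ω₂ = graftFuel (length ω₁) ω₁ ω₂

_▷L_ : {A : Set} → Lin (Forest A) → Lin (Forest A) → Lin (Forest A)
_▷L_ = bilin _▷_

data LieTerm (A : Set) : Set where
  gen : Tree A → LieTerm A
  br  : LieTerm A → LieTerm A → LieTerm A

labelsLie : {A : Set} → LieTerm A → List A
labelsLie (gen t) = labelsT t
labelsLie (br a b) = labelsLie a ++ labelsLie b

interp : {A : Set} → LieTerm A → Lin (Forest A)
interp (gen t) = (1ℤ , t ∷ []) ∷ []
interp (br a b) = concatL (interp a) (interp b) ++ neg (concatL (interp b) (interp a))

interpL : {A : Set} → Lin (LieTerm A) → Lin (Forest A)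
interpL = linmap interp

-- a bracket of trees with m vertices labelled bijectively by 1,…,m
-- (m = number of vertices); an element of \widehat{Lie(PT)} is a
-- Z-combination of such brackets (of possibly different degrees m)
StdLabelled : LieTerm ℕ → Set
StdLabelled t = labelsLie t ↭ map suc (upTo (length (labelsLie t)))

data Mono (n : ℕ) : Set where
  leaf : Fin n → Mono n
  cat  : Mono n → Mono n → Mono n
  grf  : Mono n → Mono n → Mono n

leaves : {n : ℕ} → Mono n → List (Fin n)
leaves (leaf i) = i ∷ []
leaves (cat a b) = leaves a ++ leaves b
leaves (grf a b) = leaves a ++ leaves b

evalM : {n : ℕ} {B : Set} → (Fin n → Lin (Forest B)) → Mono n → Lin (Forest B)
evalM v (leaf i) = v i
evalM v (cat a b) = concatL (evalM v a) (evalM v b)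
evalM v (grf a b) = evalM v a ▷L evalM v b

evalE : {n : ℕ} {B : Set} → (Fin n → Lin (Forest B)) → Lin (Mono n) → Lin (Forest B)
evalE v = linmap (evalM v)

vertex : {n : ℕ} → Fin n → Lin (Forest (Fin n))
vertex i = (1ℤ , node i [] ∷ []) ∷ []

splits : {X : Set} → List X → List (List X × List X)
splits [] = ([] , []) ∷ []
splits (x ∷ xs) = concatMap (λ p → (x ∷ proj₁ p , proj₂ p) ∷ (proj₁ p , x ∷ proj₂ p) ∷ []) (splits xs)

-- attach each tree of the list F by an edge from some vertex of the given
-- tree/forest to its root; trees attached at the same vertex keep their
-- order in F and are placed to the left of that vertex's own children
mutual
  attachT : {B : Set} → Tree B → List (Tree B) → List (Tree B)
  attachT (node b cs) F =
    concatMap (λ p → map (λ cs' → node b (proj₁ p ++ cs')) (attachF cs (proj₂ p))) (splits F)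

  attachF : {B : Set} → Forest B → List (Tree B) → List (Forest B)
  attachF [] [] = [] ∷ []
  attachF [] (_ ∷ _) = []
  attachF (t ∷ ts) F =
    concatMap (λ p → concatMap (λ t' → map (t' ∷_) (attachF ts (proj₂ p))) (attachT t (proj₁ p))) (splits F)

-- replace each vertex i of ω by (a linear combination of) forests σ i:
-- the children of vertex i (after their own replacement, giving the
-- concatenated forest of their roots) are attached to vertices of σ i;
-- the roots of σ i all become children of the parent of i, in order, at
-- the position of i.
mutual
  substTL : {n : ℕ} {B : Set} → (Fin n → Lin (Forest B)) → Tree (Fin n) → Lin (Forest B)
  substTL σ (node a cs) = bilin (λ f F → basis (attachF f F)) (σ a) (substFL σ cs)

  substFL : {n : ℕ} {B : Set} → (Fin n → Lin (Forest B)) → Forest (Fin n) → Lin (Forest B)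
  substFL σ [] = (1ℤ , []) ∷ []
  substFL σ (t ∷ ts) = concatL (substTL σ t) (substFL σ ts)

relabelL : {A B : Set} → (A → B) → Lin (Forest A) → Lin (Forest B)
relabelL f = map (λ p → (proj₁ p , relabelF f (proj₂ p)))

{-# OPTIONS --safe #-}
-- Two ℤ-combinations of forests are equal as soon as they have the same
-- pairing ⟦ L ⟧ h = Σ c · h x with every integer test function h, so the whole
-- argument is carried out on pairings.  Against test functions, left grafting
-- ω₁ ▷ ω₂ is the sum over all ways of attaching the trees of ω₁ to vertices of
-- ω₂, keeping the order of trees landing on a common vertex; this is derived
-- from the recursion τ ω₁ ▷ ω₂ = τ ▷ (ω₁ ▷ ω₂) − (τ ▷ ω₁) ▷ ω₂, using that
-- grafting τ is a coderivation for the deshuffle coproduct Δ.  Substituting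
-- forests for vertices is multiplicative for concatenation, and when the
-- substituted elements are primitive for Δ, as Lie polynomials in trees are,
-- it is also a Δ-coalgebra map and hence intertwines attaching with
-- attaching.  So substitution commutes with concatenation and grafting, and
-- an induction on the expression of ω in single vertices gives the theorem.
module Submission where

open import Defs
open import Data.Nat using (ℕ; zero; suc; s≤s; z≤n) renaming (_≤_ to _≤ℕ_)
open import Data.Nat.Properties using (≤-refl; ≤-trans; m≤n⇒m≤1+n; suc-injective) renaming (_≟_ to _≟ℕ_)
open import Data.Integer using (ℤ; 0ℤ; 1ℤ; _+_; _*_; -_)
open import Data.Integer.Properties
  using (+-identityʳ; +-identityˡ; +-assoc; +-inverseʳ; neg-distrib-+; *-identityˡ; *-identityʳ; *-zeroʳ; *-zeroˡ; *-distribˡ-+; *-assoc)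
open import Data.Integer.Tactic.RingSolver using (solve-∀)
open import Data.Fin using (Fin)
open import Data.Fin.Properties using () renaming (_≟_ to _≟F_)
open import Data.Product using (_×_; _,_; proj₁; proj₂)
open import Data.Product.Properties using (≡-dec)
open import Data.List using (List; []; _∷_; _++_; map; concatMap; length; allFin)
open import Data.List.Properties using (++-identityʳ; ++-assoc)
open import Data.List.Relation.Unary.All using (All)
open import Data.List.Relation.Binary.Permutation.Propositional using (_↭_)
open import Data.Empty using (⊥-elim)
open import Relation.Binary.Definitions using (DecidableEquality)
open import Relation.Nullary using (yes; no; ¬_)
open import Relation.Binary.PropositionalEquality
open ≡-Reasoning

∑ : {X : Set} → List X → (X → ℤ) → ℤ
∑ [] f = 0ℤ
∑ (x ∷ xs) f = f x + ∑ xs f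

module _ {X : Set} where
  ∑-cong : (xs : List X) {f g : X → ℤ} → (∀ x → f x ≡ g x) → ∑ xs f ≡ ∑ xs g
  ∑-cong [] e = refl
  ∑-cong (x ∷ xs) e = cong₂ _+_ (e x) (∑-cong xs e)

  ∑-++ : (xs ys : List X) (f : X → ℤ) → ∑ (xs ++ ys) f ≡ ∑ xs f + ∑ ys f
  ∑-++ [] ys f = sym (+-identityˡ _)
  ∑-++ (x ∷ xs) ys f = trans (cong (f x +_) (∑-++ xs ys f)) (sym (+-assoc (f x) (∑ xs f) (∑ ys f)))

  ∑-+ : (xs : List X) (f g : X → ℤ) → ∑ xs (λ x → f x + g x) ≡ ∑ xs f + ∑ xs g
  ∑-+ [] f g = refl
  ∑-+ (x ∷ xs) f g = trans (cong ((f x + g x) +_) (∑-+ xs f g)) (interchange (f x) (g x) (∑ xs f) (∑ xs g))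
    where interchange : ∀ a b c d → (a + b) + (c + d) ≡ (a + c) + (b + d)
          interchange = solve-∀

  ∑-* : (xs : List X) (c : ℤ) (f : X → ℤ) → ∑ xs (λ x → c * f x) ≡ c * ∑ xs f
  ∑-* [] c f = sym (*-zeroʳ c)
  ∑-* (x ∷ xs) c f = trans (cong (c * f x +_) (∑-* xs c f)) (sym (*-distribˡ-+ c (f x) (∑ xs f)))

  ∑-neg : (xs : List X) (f : X → ℤ) → ∑ xs (λ x → - f x) ≡ - ∑ xs f
  ∑-neg [] f = refl
  ∑-neg (x ∷ xs) f = trans (cong (- f x +_) (∑-neg xs f)) (sym (neg-distrib-+ (f x) (∑ xs f)))

  ∑-zero : (xs : List X) → ∑ xs (λ _ → 0ℤ) ≡ 0ℤ
  ∑-zero [] = refl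
  ∑-zero (x ∷ xs) = trans (+-identityˡ _) (∑-zero xs)

module _ {X Y : Set} where
  ∑-map : (g : Y → X) (ys : List Y) (f : X → ℤ) → ∑ (map g ys) f ≡ ∑ ys (λ y → f (g y))
  ∑-map g [] f = refl
  ∑-map g (y ∷ ys) f = cong (f (g y) +_) (∑-map g ys f)

  ∑-concatMap : (g : Y → List X) (ys : List Y) (f : X → ℤ) → ∑ (concatMap g ys) f ≡ ∑ ys (λ y → ∑ (g y) f)
  ∑-concatMap g [] f = refl
  ∑-concatMap g (y ∷ ys) f = trans (∑-++ (g y) (concatMap g ys) f) (cong (∑ (g y) f +_) (∑-concatMap g ys f))

  ∑-comm : (xs : List X) (ys : List Y) (f : X → Y → ℤ) →
    ∑ xs (λ x → ∑ ys (λ y → f x y)) ≡ ∑ ys (λ y → ∑ xs (λ x → f x y))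
  ∑-comm [] ys f = sym (∑-zero ys)
  ∑-comm (x ∷ xs) ys f = begin
      ∑ ys (f x) + ∑ xs (λ x′ → ∑ ys (f x′))
    ≡⟨ cong (∑ ys (f x) +_) (∑-comm xs ys f) ⟩
      ∑ ys (f x) + ∑ ys (λ y → ∑ xs (λ x′ → f x′ y))
    ≡⟨ sym (∑-+ ys (f x) (λ y → ∑ xs (λ x′ → f x′ y))) ⟩
      ∑ ys (λ y → f x y + ∑ xs (λ x′ → f x′ y)) ∎

⟦_⟧ : {X : Set} → Lin X → (X → ℤ) → ℤ
⟦ L ⟧ h = ∑ L (λ p → proj₁ p * h (proj₂ p))

module _ {X : Set} where
  ⟦⟧-cong : (L : Lin X) {h k : X → ℤ} → (∀ x → h x ≡ k x) → ⟦ L ⟧ h ≡ ⟦ L ⟧ k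
  ⟦⟧-cong L e = ∑-cong L (λ p → cong (proj₁ p *_) (e (proj₂ p)))

  ⟦⟧-++ : (L M : Lin X) (h : X → ℤ) → ⟦ L ++ M ⟧ h ≡ ⟦ L ⟧ h + ⟦ M ⟧ h
  ⟦⟧-++ L M h = ∑-++ L M _

  ⟦⟧-+ : (L : Lin X) (h k : X → ℤ) → ⟦ L ⟧ (λ x → h x + k x) ≡ ⟦ L ⟧ h + ⟦ L ⟧ k
  ⟦⟧-+ L h k = trans (∑-cong L (λ p → *-distribˡ-+ (proj₁ p) (h (proj₂ p)) (k (proj₂ p)))) (∑-+ L _ _)

  ⟦⟧-* : (L : Lin X) (c : ℤ) (h : X → ℤ) → ⟦ L ⟧ (λ x → c * h x) ≡ c * ⟦ L ⟧ h
  ⟦⟧-* L c h = trans (∑-cong L (λ p → swap (proj₁ p) c (h (proj₂ p)))) (∑-* L c _)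
    where swap : ∀ a c b → a * (c * b) ≡ c * (a * b)
          swap = solve-∀

  ⟦⟧-zero : (L : Lin X) → ⟦ L ⟧ (λ _ → 0ℤ) ≡ 0ℤ
  ⟦⟧-zero L = trans (∑-cong L (λ p → *-zeroʳ (proj₁ p))) (∑-zero L)

  ⟦⟧-scale : (c : ℤ) (L : Lin X) (h : X → ℤ) → ⟦ scale c L ⟧ h ≡ c * ⟦ L ⟧ h
  ⟦⟧-scale c L h = trans (∑-map _ L _) (trans (∑-cong L (λ p → *-assoc c (proj₁ p) (h (proj₂ p)))) (∑-* L c _))

  ⟦⟧-neg : (L : Lin X) (h : X → ℤ) → ⟦ neg L ⟧ h ≡ - ⟦ L ⟧ h
  ⟦⟧-neg L h = trans (∑-map _ L _) (trans (∑-cong L (λ p → neg-* (proj₁ p) (h (proj₂ p)))) (∑-neg L _))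
    where neg-* : ∀ a b → (- a) * b ≡ - (a * b)
          neg-* = solve-∀
  ⟦⟧-basis : (xs : List X) (h : X → ℤ) → ⟦ basis xs ⟧ h ≡ ∑ xs h
  ⟦⟧-basis xs h = trans (∑-map _ xs _) (∑-cong xs (λ x → *-identityˡ (h x)))

  ⟦⟧-single : (x : X) (h : X → ℤ) → ⟦ (1ℤ , x) ∷ [] ⟧ h ≡ h x
  ⟦⟧-single x h = trans (+-identityʳ _) (*-identityˡ (h x))

  ⟦⟧-∑ : {R : Set} (L : Lin X) (rs : List R) (f : X → R → ℤ) →
    ⟦ L ⟧ (λ x → ∑ rs (λ r → f x r)) ≡ ∑ rs (λ r → ⟦ L ⟧ (λ x → f x r))
  ⟦⟧-∑ L rs f = begin
      ∑ L (λ p → proj₁ p * ∑ rs (f (proj₂ p)))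
    ≡⟨ ∑-cong L (λ p → sym (∑-* rs (proj₁ p) (f (proj₂ p)))) ⟩
      ∑ L (λ p → ∑ rs (λ r → proj₁ p * f (proj₂ p) r))
    ≡⟨ ∑-comm L rs _ ⟩
      ∑ rs (λ r → ⟦ L ⟧ (λ x → f x r)) ∎

module _ {X Y : Set} where
  ⟦⟧-linmap : (g : X → Lin Y) (L : Lin X) (h : Y → ℤ) → ⟦ linmap g L ⟧ h ≡ ⟦ L ⟧ (λ x → ⟦ g x ⟧ h)
  ⟦⟧-linmap g L h = trans (∑-concatMap _ L _) (∑-cong L (λ p → ⟦⟧-scale (proj₁ p) (g (proj₂ p)) h))

  ⟦⟧-comm : (L : Lin X) (M : Lin Y) (f : X → Y → ℤ) →
    ⟦ L ⟧ (λ x → ⟦ M ⟧ (λ y → f x y)) ≡ ⟦ M ⟧ (λ y → ⟦ L ⟧ (λ x → f x y))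
  ⟦⟧-comm L M f = begin
      ∑ L (λ p → proj₁ p * ∑ M (λ q → proj₁ q * f (proj₂ p) (proj₂ q)))
    ≡⟨ ⟦⟧-∑ L M (λ x q → proj₁ q * f x (proj₂ q)) ⟩
      ∑ M (λ q → ⟦ L ⟧ (λ x → proj₁ q * f x (proj₂ q)))
    ≡⟨ ∑-cong M (λ q → ⟦⟧-* L (proj₁ q) (λ x → f x (proj₂ q))) ⟩
      ∑ M (λ q → proj₁ q * ⟦ L ⟧ (λ x → f x (proj₂ q))) ∎

module _ {X Y Z : Set} where
  ⟦⟧-bilin : (f : X → Y → Lin Z) (L : Lin X) (M : Lin Y) (h : Z → ℤ) →
    ⟦ bilin f L M ⟧ h ≡ ⟦ L ⟧ (λ x → ⟦ M ⟧ (λ y → ⟦ f x y ⟧ h))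
  ⟦⟧-bilin f L M h = trans (⟦⟧-linmap _ L h) (⟦⟧-cong L (λ x → ⟦⟧-linmap (f x) M h))

⟦⟧-concatL : {A : Set} (L M : Lin (Forest A)) (h : Forest A → ℤ) →
  ⟦ concatL L M ⟧ h ≡ ⟦ L ⟧ (λ x → ⟦ M ⟧ (λ y → h (x ++ y)))
⟦⟧-concatL L M h = trans (⟦⟧-bilin (λ x y → (1ℤ , x ++ y) ∷ []) L M h) (⟦⟧-cong L (λ x → ⟦⟧-cong M (λ y → ⟦⟧-single (x ++ y) h)))

module _ {X : Set} (_≟_ : DecidableEquality X) where
  indicator : X → X → ℤ
  indicator x y with y ≟ x
  ... | yes _ = 1ℤ
  ... | no _ = 0ℤ

  coeff≡⟦⟧-indicator : (x : X) (L : Lin X) → coeff _≟_ x L ≡ ⟦ L ⟧ (indicator x)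
  coeff≡⟦⟧-indicator x [] = refl
  coeff≡⟦⟧-indicator x ((c , y) ∷ L) with y ≟ x
  ... | yes _ = cong₂ _+_ (sym (*-identityʳ c)) (coeff≡⟦⟧-indicator x L)
  ... | no _ = trans (coeff≡⟦⟧-indicator x L) (sym (trans (cong (_+ ⟦ L ⟧ (indicator x)) (*-zeroʳ c)) (+-identityˡ _)))

  without : X → Lin X → Lin X
  without x [] = []
  without x ((c , y) ∷ L) with y ≟ x
  ... | yes _ = without x L
  ... | no _ = (c , y) ∷ without x L

  ⟦⟧-without : (x : X) (L : Lin X) (h : X → ℤ) → ⟦ L ⟧ h ≡ coeff _≟_ x L * h x + ⟦ without x L ⟧ h
  ⟦⟧-without x [] h = sym (trans (+-identityʳ _) (*-zeroˡ (h x)))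
  ⟦⟧-without x ((c , y) ∷ L) h with y ≟ x
  ... | yes refl = trans (cong (c * h y +_) (⟦⟧-without x L h)) (collect c (coeff _≟_ x L) (h x) (⟦ without x L ⟧ h))
    where collect : ∀ a b c e → a * c + (b * c + e) ≡ (a + b) * c + e
          collect = solve-∀
  ... | no _ = trans (cong (c * h y +_) (⟦⟧-without x L h)) (swap (c * h y) (coeff _≟_ x L * h x) (⟦ without x L ⟧ h))
    where swap : ∀ a b e → a + (b + e) ≡ b + (a + e)
          swap = solve-∀

  coeff-without-self : (x : X) (L : Lin X) → coeff _≟_ x (without x L) ≡ 0ℤ
  coeff-without-self x [] = refl
  coeff-without-self x ((c , y) ∷ L) with y ≟ x
  ... | yes _ = coeff-without-self x L
  ... | no y≢x with y ≟ x
  ...   | yes y≡x = ⊥-elim (y≢x y≡x)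
  ...   | no _ = coeff-without-self x L

  coeff-without-other : (x y : X) (L : Lin X) → ¬ x ≡ y → coeff _≟_ x (without y L) ≡ coeff _≟_ x L
  coeff-without-other x y [] _ = refl
  coeff-without-other x y ((c , z) ∷ L) x≢y with z ≟ y
  ... | yes refl with z ≟ x
  ...   | yes refl = ⊥-elim (x≢y refl)
  ...   | no _ = coeff-without-other x y L x≢y
  coeff-without-other x y ((c , z) ∷ L) x≢y | no _ with z ≟ x
  ...   | yes _ = cong (c +_) (coeff-without-other x y L x≢y)
  ...   | no _ = coeff-without-other x y L x≢y

  length-without : (x : X) (L : Lin X) → length (without x L) ≤ℕ length L
  length-without x [] = z≤n
  length-without x ((c , y) ∷ L) with y ≟ x
  ... | yes _ = m≤n⇒m≤1+n (length-without x L)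
  ... | no _ = s≤s (length-without x L)

  length-without-∷ : (c : ℤ) (x : X) (L : Lin X) → length (without x ((c , x) ∷ L)) ≤ℕ length L
  length-without-∷ c x L with x ≟ x
  ... | yes _ = length-without x L
  ... | no x≢x = ⊥-elim (x≢x refl)

  ⟦⟧-coeff-zero : (n : ℕ) (K : Lin X) → length K ≤ℕ n → (∀ x → coeff _≟_ x K ≡ 0ℤ) → ∀ h → ⟦ K ⟧ h ≡ 0ℤ
  ⟦⟧-coeff-zero _ [] _ _ h = refl
  ⟦⟧-coeff-zero (suc n) K@((c , x) ∷ K′) (s≤s K′≤n) coeff-zero h = begin
      ⟦ K ⟧ h
    ≡⟨ ⟦⟧-without x K h ⟩
      coeff _≟_ x K * h x + ⟦ without x K ⟧ h
    ≡⟨ cong₂ _+_ (trans (cong (_* h x) (coeff-zero x)) (*-zeroˡ (h x)))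
                 (⟦⟧-coeff-zero n (without x K) (≤-trans (length-without-∷ c x K′) K′≤n) coeff-without-zero h) ⟩
      0ℤ ∎
    where
      coeff-without-zero : ∀ y → coeff _≟_ y (without x K) ≡ 0ℤ
      coeff-without-zero y with y ≟ x
      ... | yes refl = coeff-without-self y K
      ... | no y≢x = trans (coeff-without-other y x K y≢x) (coeff-zero y)

  LinEq⇒⟦⟧≡ : (L M : Lin X) → (∀ x → coeff _≟_ x L ≡ coeff _≟_ x M) → ∀ h → ⟦ L ⟧ h ≡ ⟦ M ⟧ h
  LinEq⇒⟦⟧≡ L M coeff-eq h = begin
      ⟦ L ⟧ h
    ≡⟨ add-sub (⟦ L ⟧ h) (⟦ M ⟧ h) ⟩
      (⟦ L ⟧ h + - ⟦ M ⟧ h) + ⟦ M ⟧ h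
    ≡⟨ cong (_+ ⟦ M ⟧ h) (difference h) ⟩
      ⟦ L ++ neg M ⟧ h + ⟦ M ⟧ h
    ≡⟨ cong (_+ ⟦ M ⟧ h) (⟦⟧-coeff-zero (length (L ++ neg M)) (L ++ neg M) ≤-refl coeff-zero h) ⟩
      0ℤ + ⟦ M ⟧ h
    ≡⟨ +-identityˡ _ ⟩
      ⟦ M ⟧ h ∎
    where
      add-sub : ∀ a b → a ≡ (a + - b) + b
      add-sub = solve-∀
      difference : ∀ h → ⟦ L ⟧ h + - ⟦ M ⟧ h ≡ ⟦ L ++ neg M ⟧ h
      difference h = sym (trans (⟦⟧-++ L (neg M) h) (cong (⟦ L ⟧ h +_) (⟦⟧-neg M h)))
      coeff-zero : ∀ x → coeff _≟_ x (L ++ neg M) ≡ 0ℤ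
      coeff-zero x = begin
          coeff _≟_ x (L ++ neg M)
        ≡⟨ coeff≡⟦⟧-indicator x (L ++ neg M) ⟩
          ⟦ L ++ neg M ⟧ (indicator x)
        ≡⟨ sym (difference (indicator x)) ⟩
          ⟦ L ⟧ (indicator x) + - ⟦ M ⟧ (indicator x)
        ≡⟨ cong (λ a → a + - ⟦ M ⟧ (indicator x)) (trans (sym (coeff≡⟦⟧-indicator x L)) (trans (coeff-eq x) (coeff≡⟦⟧-indicator x M))) ⟩
          ⟦ M ⟧ (indicator x) + - ⟦ M ⟧ (indicator x)
        ≡⟨ +-inverseʳ (⟦ M ⟧ (indicator x)) ⟩
          0ℤ ∎

  ⟦⟧≡⇒LinEq : (L M : Lin X) → (∀ h → ⟦ L ⟧ h ≡ ⟦ M ⟧ h) → ∀ x → coeff _≟_ x L ≡ coeff _≟_ x M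
  ⟦⟧≡⇒LinEq L M eq x = trans (coeff≡⟦⟧-indicator x L) (trans (eq (indicator x)) (sym (coeff≡⟦⟧-indicator x M)))

-- The deshuffle coproduct

module _ {X : Set} where
  -- Δ F H pairs Δ F = Σ a ⊗ b, over the splittings of F into a subsequence
  -- and its complement, with a test function H of two arguments.
  Δ : List X → (List X → List X → ℤ) → ℤ
  Δ F H = ∑ (splits F) (λ p → H (proj₁ p) (proj₂ p))

  Δ-∷ : (x : X) (xs : List X) (H : List X → List X → ℤ) →
    Δ (x ∷ xs) H ≡ Δ xs (λ a b → H (x ∷ a) b + H a (x ∷ b))
  Δ-∷ x xs H = trans (∑-concatMap _ (splits xs) _)
    (∑-cong (splits xs) (λ p → cong (H (x ∷ proj₁ p) (proj₂ p) +_) (+-identityʳ _)))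

  Δ-[] : (H : List X → List X → ℤ) → Δ [] H ≡ H [] []
  Δ-[] H = +-identityʳ _

  Δ-cong : (F : List X) {H K : List X → List X → ℤ} → (∀ a b → H a b ≡ K a b) → Δ F H ≡ Δ F K
  Δ-cong F e = ∑-cong (splits F) (λ p → e (proj₁ p) (proj₂ p))

  Δ-+ : (F : List X) (H K : List X → List X → ℤ) → Δ F (λ a b → H a b + K a b) ≡ Δ F H + Δ F K
  Δ-+ F H K = ∑-+ (splits F) _ _

  Δ-zero : (F : List X) → Δ F (λ _ _ → 0ℤ) ≡ 0ℤ
  Δ-zero F = ∑-zero (splits F)

  -- Each is a sum over colourings of F, so the identities
  -- between them below are reindexings, proved by induction on F.
  Δ²ʳ : List X → (List X → List X → List X → ℤ) → ℤ
  Δ²ʳ F H = Δ F (λ a b → Δ b (λ b1 b2 → H a b1 b2))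

  Δ²ˡ : List X → (List X → List X → List X → ℤ) → ℤ
  Δ²ˡ F H = Δ F (λ F₁ F₂ → Δ F₁ (λ a b1 → H a b1 F₂))

  Δ⊗Δ : List X → (List X → List X → List X → List X → ℤ) → ℤ
  Δ⊗Δ F H = Δ F (λ a b → Δ a (λ a1 a2 → Δ b (λ b1 b2 → H a1 a2 b1 b2)))

  Δ³ʳ : List X → (List X → List X → List X → List X → ℤ) → ℤ
  Δ³ʳ F H = Δ F (λ F₁ F₂ → Δ F₂ (λ u v → Δ v (λ v1 v2 → H F₁ u v1 v2)))

  Δ²ʳ-cong : (F : List X) {H K : List X → List X → List X → ℤ} → (∀ a b c → H a b c ≡ K a b c) → Δ²ʳ F H ≡ Δ²ʳ F K
  Δ²ʳ-cong F e = Δ-cong F (λ a b → Δ-cong b (λ b1 b2 → e a b1 b2))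

  Δ²ˡ-cong : (F : List X) {H K : List X → List X → List X → ℤ} → (∀ a b c → H a b c ≡ K a b c) → Δ²ˡ F H ≡ Δ²ˡ F K
  Δ²ˡ-cong F e = Δ-cong F (λ F₁ F₂ → Δ-cong F₁ (λ a b1 → e a b1 F₂))

  Δ⊗Δ-cong : (F : List X) {H K : List X → List X → List X → List X → ℤ} → (∀ a b c d → H a b c d ≡ K a b c d) → Δ⊗Δ F H ≡ Δ⊗Δ F K
  Δ⊗Δ-cong F e = Δ-cong F (λ a b → Δ-cong a (λ a1 a2 → Δ-cong b (λ b1 b2 → e a1 a2 b1 b2)))

  Δ²ʳ-∷ : (x : X) (xs : List X) (H : List X → List X → List X → ℤ) →
    Δ²ʳ (x ∷ xs) H ≡ Δ²ʳ xs (λ a b1 b2 → H (x ∷ a) b1 b2 + (H a (x ∷ b1) b2 + H a b1 (x ∷ b2)))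
  Δ²ʳ-∷ x xs H = begin
      Δ (x ∷ xs) (λ a b → Δ b (H a))
    ≡⟨ Δ-∷ x xs _ ⟩
      Δ xs (λ a b → Δ b (H (x ∷ a)) + Δ (x ∷ b) (H a))
    ≡⟨ Δ-cong xs (λ a b → cong (Δ b (H (x ∷ a)) +_) (Δ-∷ x b (H a))) ⟩
      Δ xs (λ a b → Δ b (H (x ∷ a)) + Δ b (λ b1 b2 → H a (x ∷ b1) b2 + H a b1 (x ∷ b2)))
    ≡⟨ Δ-cong xs (λ a b → sym (Δ-+ b _ _)) ⟩
      Δ²ʳ xs (λ a b1 b2 → H (x ∷ a) b1 b2 + (H a (x ∷ b1) b2 + H a b1 (x ∷ b2))) ∎

  Δ²ˡ-∷ : (x : X) (xs : List X) (H : List X → List X → List X → ℤ) →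
    Δ²ˡ (x ∷ xs) H ≡ Δ²ˡ xs (λ a b1 F₂ → (H (x ∷ a) b1 F₂ + H a (x ∷ b1) F₂) + H a b1 (x ∷ F₂))
  Δ²ˡ-∷ x xs H = begin
      Δ (x ∷ xs) (λ F₁ F₂ → Δ F₁ (λ a b1 → H a b1 F₂))
    ≡⟨ Δ-∷ x xs _ ⟩
      Δ xs (λ F₁ F₂ → Δ (x ∷ F₁) (λ a b1 → H a b1 F₂) + Δ F₁ (λ a b1 → H a b1 (x ∷ F₂)))
    ≡⟨ Δ-cong xs (λ F₁ F₂ → cong (_+ Δ F₁ (λ a b1 → H a b1 (x ∷ F₂))) (Δ-∷ x F₁ _)) ⟩
      Δ xs (λ F₁ F₂ → Δ F₁ (λ a b1 → H (x ∷ a) b1 F₂ + H a (x ∷ b1) F₂) + Δ F₁ (λ a b1 → H a b1 (x ∷ F₂)))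
    ≡⟨ Δ-cong xs (λ F₁ F₂ → sym (Δ-+ F₁ _ _)) ⟩
      Δ²ˡ xs (λ a b1 F₂ → (H (x ∷ a) b1 F₂ + H a (x ∷ b1) F₂) + H a b1 (x ∷ F₂)) ∎

  Δ-coassoc : (F : List X) (H : List X → List X → List X → ℤ) → Δ²ʳ F H ≡ Δ²ˡ F H
  Δ-coassoc [] H = refl
  Δ-coassoc (x ∷ xs) H = begin
      Δ²ʳ (x ∷ xs) H
    ≡⟨ Δ²ʳ-∷ x xs H ⟩
      Δ²ʳ xs _
    ≡⟨ Δ-coassoc xs _ ⟩
      Δ²ˡ xs (λ a b1 b2 → H (x ∷ a) b1 b2 + (H a (x ∷ b1) b2 + H a b1 (x ∷ b2)))
    ≡⟨ Δ²ˡ-cong xs (λ a b c → regroup (H (x ∷ a) b c) (H a (x ∷ b) c) (H a b (x ∷ c))) ⟩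
      Δ²ˡ xs _
    ≡⟨ sym (Δ²ˡ-∷ x xs H) ⟩
      Δ²ˡ (x ∷ xs) H ∎
    where regroup : ∀ p q r → p + (q + r) ≡ (p + q) + r
          regroup = solve-∀

  Δ²ʳ-swap : (F : List X) (H : List X → List X → List X → ℤ) → Δ²ʳ F H ≡ Δ²ʳ F (λ a b c → H b a c)
  Δ²ʳ-swap [] H = refl
  Δ²ʳ-swap (x ∷ xs) H = begin
      Δ²ʳ (x ∷ xs) H
    ≡⟨ Δ²ʳ-∷ x xs H ⟩
      Δ²ʳ xs _
    ≡⟨ Δ²ʳ-swap xs _ ⟩
      Δ²ʳ xs (λ a b c → H (x ∷ b) a c + (H b (x ∷ a) c + H b a (x ∷ c)))
    ≡⟨ Δ²ʳ-cong xs (λ a b c → regroup (H (x ∷ b) a c) (H b (x ∷ a) c) (H b a (x ∷ c))) ⟩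
      Δ²ʳ xs _
    ≡⟨ sym (Δ²ʳ-∷ x xs (λ a b c → H b a c)) ⟩
      Δ²ʳ (x ∷ xs) (λ a b c → H b a c) ∎
    where regroup : ∀ p q r → p + (q + r) ≡ q + (p + r)
          regroup = solve-∀

  Δ⊗Δ-∷ : (x : X) (xs : List X) (H : List X → List X → List X → List X → ℤ) →
    Δ⊗Δ (x ∷ xs) H ≡ Δ⊗Δ xs (λ a1 a2 b1 b2 → (H (x ∷ a1) a2 b1 b2 + H a1 (x ∷ a2) b1 b2) + (H a1 a2 (x ∷ b1) b2 + H a1 a2 b1 (x ∷ b2)))
  Δ⊗Δ-∷ x xs H = begin
      Δ (x ∷ xs) (λ a b → Δ a (λ a1 a2 → Δ b (H a1 a2)))
    ≡⟨ Δ-∷ x xs _ ⟩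
      Δ xs (λ a b → Δ (x ∷ a) (λ a1 a2 → Δ b (H a1 a2)) + Δ a (λ a1 a2 → Δ (x ∷ b) (H a1 a2)))
    ≡⟨ Δ-cong xs (λ a b → cong₂ _+_ (Δ-∷ x a _) (Δ-cong a (λ a1 a2 → Δ-∷ x b (H a1 a2)))) ⟩
      Δ xs (λ a b → Δ a (λ a1 a2 → Δ b (H (x ∷ a1) a2) + Δ b (H a1 (x ∷ a2)))
                   + Δ a (λ a1 a2 → Δ b (λ b1 b2 → H a1 a2 (x ∷ b1) b2 + H a1 a2 b1 (x ∷ b2))))
    ≡⟨ Δ-cong xs (λ a b → trans (sym (Δ-+ a _ _)) (Δ-cong a (λ a1 a2 →
          trans (cong (_+ Δ b (λ b1 b2 → H a1 a2 (x ∷ b1) b2 + H a1 a2 b1 (x ∷ b2))) (sym (Δ-+ b _ _)))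
                (sym (Δ-+ b _ _))))) ⟩
      Δ⊗Δ xs _ ∎

  Δ³ʳ-∷ : (x : X) (xs : List X) (H : List X → List X → List X → List X → ℤ) →
    Δ³ʳ (x ∷ xs) H ≡ Δ³ʳ xs (λ F₁ u v1 v2 → H (x ∷ F₁) u v1 v2 + (H F₁ (x ∷ u) v1 v2 + (H F₁ u (x ∷ v1) v2 + H F₁ u v1 (x ∷ v2))))
  Δ³ʳ-∷ x xs H = begin
      Δ (x ∷ xs) (λ F₁ F₂ → Δ F₂ (λ u v → Δ v (H F₁ u)))
    ≡⟨ Δ-∷ x xs _ ⟩
      Δ xs (λ F₁ F₂ → Δ F₂ (λ u v → Δ v (H (x ∷ F₁) u)) + Δ (x ∷ F₂) (λ u v → Δ v (H F₁ u)))
    ≡⟨ Δ-cong xs (λ F₁ F₂ → cong (Δ F₂ (λ u v → Δ v (H (x ∷ F₁) u)) +_)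
          (trans (Δ-∷ x F₂ _) (Δ-cong F₂ (λ u v → cong (Δ v (H F₁ (x ∷ u)) +_) (Δ-∷ x v (H F₁ u)))))) ⟩
      Δ xs (λ F₁ F₂ → Δ F₂ (λ u v → Δ v (H (x ∷ F₁) u))
        + Δ F₂ (λ u v → Δ v (H F₁ (x ∷ u)) + Δ v (λ v1 v2 → H F₁ u (x ∷ v1) v2 + H F₁ u v1 (x ∷ v2))))
    ≡⟨ Δ-cong xs (λ F₁ F₂ → trans (cong (Δ F₂ (λ u v → Δ v (H (x ∷ F₁) u)) +_)
          (Δ-cong F₂ (λ u v → sym (Δ-+ v _ _)))) (trans (sym (Δ-+ F₂ _ _))
          (Δ-cong F₂ (λ u v → sym (Δ-+ v _ _))))) ⟩
      Δ³ʳ xs _ ∎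

  Δ⊗Δ-interchange : (F : List X) (H : List X → List X → List X → List X → ℤ) →
    Δ⊗Δ F H ≡ Δ⊗Δ F (λ a1 b1 a2 b2 → H a1 a2 b1 b2)
  Δ⊗Δ-interchange [] H = refl
  Δ⊗Δ-interchange (x ∷ xs) H = begin
      Δ⊗Δ (x ∷ xs) H
    ≡⟨ Δ⊗Δ-∷ x xs H ⟩
      Δ⊗Δ xs _
    ≡⟨ Δ⊗Δ-interchange xs _ ⟩
      Δ⊗Δ xs (λ a1 b1 a2 b2 → (H (x ∷ a1) a2 b1 b2 + H a1 (x ∷ a2) b1 b2) + (H a1 a2 (x ∷ b1) b2 + H a1 a2 b1 (x ∷ b2)))
    ≡⟨ Δ⊗Δ-cong xs (λ a b c d → regroup (H (x ∷ a) c b d) (H a (x ∷ c) b d) (H a c (x ∷ b) d) (H a c b (x ∷ d))) ⟩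
      Δ⊗Δ xs _
    ≡⟨ sym (Δ⊗Δ-∷ x xs _) ⟩
      Δ⊗Δ (x ∷ xs) (λ a1 b1 a2 b2 → H a1 a2 b1 b2) ∎
    where regroup : ∀ p q r s → (p + q) + (r + s) ≡ (p + r) + (q + s)
          regroup = solve-∀

  Δ³ʳ≡Δ⊗Δ : (F : List X) (H : List X → List X → List X → List X → ℤ) →
    Δ³ʳ F H ≡ Δ⊗Δ F (λ a1 c1 u v → H a1 u c1 v)
  Δ³ʳ≡Δ⊗Δ [] H = refl
  Δ³ʳ≡Δ⊗Δ (x ∷ xs) H = begin
      Δ³ʳ (x ∷ xs) H
    ≡⟨ Δ³ʳ-∷ x xs H ⟩
      Δ³ʳ xs _
    ≡⟨ Δ³ʳ≡Δ⊗Δ xs _ ⟩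
      Δ⊗Δ xs (λ a1 c1 u v → H (x ∷ a1) u c1 v + (H a1 (x ∷ u) c1 v + (H a1 u (x ∷ c1) v + H a1 u c1 (x ∷ v))))
    ≡⟨ Δ⊗Δ-cong xs (λ a b c d → regroup (H (x ∷ a) c b d) (H a (x ∷ c) b d) (H a c (x ∷ b) d) (H a c b (x ∷ d))) ⟩
      Δ⊗Δ xs _
    ≡⟨ sym (Δ⊗Δ-∷ x xs _) ⟩
      Δ⊗Δ (x ∷ xs) (λ a1 c1 u v → H a1 u c1 v) ∎
    where regroup : ∀ p q r s → p + (q + (r + s)) ≡ (p + r) + (q + s)
          regroup = solve-∀

  Δ-++ : (x y : List X) (H : List X → List X → ℤ) →
    Δ (x ++ y) H ≡ Δ x (λ x1 x2 → Δ y (λ y1 y2 → H (x1 ++ y1) (x2 ++ y2)))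
  Δ-++ [] y H = sym (Δ-[] (λ x1 x2 → Δ y (λ y1 y2 → H (x1 ++ y1) (x2 ++ y2))))
  Δ-++ (z ∷ x) y H = begin
      Δ (z ∷ (x ++ y)) H
    ≡⟨ Δ-∷ z (x ++ y) H ⟩
      Δ (x ++ y) (λ a b → H (z ∷ a) b + H a (z ∷ b))
    ≡⟨ Δ-++ x y _ ⟩
      Δ x (λ x1 x2 → Δ y (λ y1 y2 → H (z ∷ x1 ++ y1) (x2 ++ y2) + H (x1 ++ y1) (z ∷ x2 ++ y2)))
    ≡⟨ Δ-cong x (λ x1 x2 → Δ-+ y _ _) ⟩
      Δ x (λ x1 x2 → Δ y (λ y1 y2 → H (z ∷ x1 ++ y1) (x2 ++ y2)) + Δ y (λ y1 y2 → H (x1 ++ y1) (z ∷ x2 ++ y2)))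
    ≡⟨ sym (Δ-∷ z x _) ⟩
      Δ (z ∷ x) (λ x1 x2 → Δ y (λ y1 y2 → H (x1 ++ y1) (x2 ++ y2))) ∎

module _ {X Z : Set} where
  ∑-Δ : (xs : List Z) (G : List X) (f : Z → List X → List X → ℤ) →
    ∑ xs (λ z → Δ G (λ a b → f z a b)) ≡ Δ G (λ a b → ∑ xs (λ z → f z a b))
  ∑-Δ xs G f = ∑-comm xs (splits G) (λ z p → f z (proj₁ p) (proj₂ p))

module _ {X Y : Set} where
  ⟦⟧-Δ : (L : Lin X) (F : List Y) (f : X → List Y → List Y → ℤ) →
    ⟦ L ⟧ (λ x → Δ F (λ a b → f x a b)) ≡ Δ F (λ a b → ⟦ L ⟧ (λ x → f x a b))
  ⟦⟧-Δ L F f = ⟦⟧-∑ L (splits F) (λ x p → f x (proj₁ p) (proj₂ p))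

module _ {X : Set} where
  Δ-Δ : (F G : List X) (f : List X → List X → List X → List X → ℤ) →
    Δ F (λ a b → Δ G (λ c d → f a b c d)) ≡ Δ G (λ c d → Δ F (λ a b → f a b c d))
  Δ-Δ F G f = ∑-comm (splits F) (splits G) (λ p q → f (proj₁ p) (proj₂ p) (proj₁ q) (proj₂ q))

-- Attaching trees to the vertices of a forest

module _ {B : Set} where
  ∑attach : Forest B → List (Tree B) → (Forest B → ℤ) → ℤ
  ∑attach g F k = ∑ (attachF g F) k

  ∑attachT : Tree B → List (Tree B) → (Tree B → ℤ) → ℤ
  ∑attachT t F k = ∑ (attachT t F) k

  ∑attachT-node : (b : B) (cs F : List (Tree B)) (k : Tree B → ℤ) →
    ∑attachT (node b cs) F k ≡ Δ F (λ p q → ∑attach cs q (λ cs' → k (node b (p ++ cs'))))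
  ∑attachT-node b cs F k = trans (∑-concatMap _ (splits F) k) (∑-cong (splits F) (λ p → ∑-map _ (attachF cs (proj₂ p)) k))

  ∑attach-∷ : (t : Tree B) (ts F : List (Tree B)) (k : Forest B → ℤ) →
    ∑attach (t ∷ ts) F k ≡ Δ F (λ p q → ∑attachT t p (λ t' → ∑attach ts q (λ r → k (t' ∷ r))))
  ∑attach-∷ t ts F k = trans (∑-concatMap _ (splits F) k) (∑-cong (splits F) (λ p →
    trans (∑-concatMap _ (attachT t (proj₁ p)) k) (∑-cong (attachT t (proj₁ p)) (λ t' → ∑-map _ (attachF ts (proj₂ p)) k))))

  ∑attach-cong : (g : Forest B) (F : List (Tree B)) {h k : Forest B → ℤ} → (∀ x → h x ≡ k x) → ∑attach g F h ≡ ∑attach g F k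
  ∑attach-cong g F e = ∑-cong (attachF g F) e

  ∑attachT-cong : (t : Tree B) (F : List (Tree B)) {h k : Tree B → ℤ} → (∀ x → h x ≡ k x) → ∑attachT t F h ≡ ∑attachT t F k
  ∑attachT-cong t F e = ∑-cong (attachT t F) e

  ∑attach-[]-[] : (k : Forest B → ℤ) → ∑attach [] [] k ≡ k []
  ∑attach-[]-[] k = +-identityʳ _

  mutual
    attachT-[] : (t : Tree B) → attachT t [] ≡ t ∷ []
    attachT-[] (node b cs) rewrite attachF-[] cs = refl

    attachF-[] : (f : Forest B) → attachF f [] ≡ f ∷ []
    attachF-[] [] = refl
    attachF-[] (t ∷ ts) rewrite attachT-[] t | attachF-[] ts = refl

  ∑attach-[]ʳ : (f : Forest B) (k : Forest B → ℤ) → ∑attach f [] k ≡ k f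
  ∑attach-[]ʳ f k rewrite attachF-[] f = +-identityʳ _

  ∑attach-[]-nonempty : (F : List (Tree B)) (t : Tree B) (F′ : List (Tree B)) (k : Forest B → ℤ) →
    ∑attach [] (F ++ t ∷ F′) k ≡ 0ℤ
  ∑attach-[]-nonempty [] t F′ k = refl
  ∑attach-[]-nonempty (_ ∷ F) t F′ k = refl

  Δ-∑attach-[]ˡ : (F : List (Tree B)) (H : Forest B → List (Tree B) → ℤ) →
    Δ F (λ F₁ F₂ → ∑attach [] F₁ (λ x → H x F₂)) ≡ H [] F
  Δ-∑attach-[]ˡ [] H = trans (Δ-[] (λ F₁ F₂ → ∑attach [] F₁ (λ x → H x F₂))) (∑attach-[]-[] (λ x → H x []))
  Δ-∑attach-[]ˡ (t ∷ F) H = begin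
      Δ (t ∷ F) (λ F₁ F₂ → ∑attach [] F₁ (λ x → H x F₂))
    ≡⟨ Δ-∷ t F _ ⟩
      Δ F (λ F₁ F₂ → 0ℤ + ∑attach [] F₁ (λ x → H x (t ∷ F₂)))
    ≡⟨ Δ-cong F (λ F₁ F₂ → +-identityˡ _) ⟩
      Δ F (λ F₁ F₂ → ∑attach [] F₁ (λ x → H x (t ∷ F₂)))
    ≡⟨ Δ-∑attach-[]ˡ F (λ x F₂ → H x (t ∷ F₂)) ⟩
      H [] (t ∷ F) ∎

  Δ-∑attach-[]ʳ : (F : List (Tree B)) (H : List (Tree B) → Forest B → ℤ) →
    Δ F (λ F₁ F₂ → ∑attach [] F₂ (λ x → H F₁ x)) ≡ H F []
  Δ-∑attach-[]ʳ [] H = trans (Δ-[] (λ F₁ F₂ → ∑attach [] F₂ (λ x → H F₁ x))) (∑attach-[]-[] (λ x → H [] x))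
  Δ-∑attach-[]ʳ (t ∷ F) H = begin
      Δ (t ∷ F) (λ F₁ F₂ → ∑attach [] F₂ (λ x → H F₁ x))
    ≡⟨ Δ-∷ t F _ ⟩
      Δ F (λ F₁ F₂ → ∑attach [] F₂ (λ x → H (t ∷ F₁) x) + 0ℤ)
    ≡⟨ Δ-cong F (λ F₁ F₂ → +-identityʳ _) ⟩
      Δ F (λ F₁ F₂ → ∑attach [] F₂ (λ x → H (t ∷ F₁) x))
    ≡⟨ Δ-∑attach-[]ʳ F (λ F₁ x → H (t ∷ F₁) x) ⟩
      H (t ∷ F) [] ∎

  ∑attach-++ : (g1 g2 : Forest B) (F : List (Tree B)) (k : Forest B → ℤ) →
    ∑attach (g1 ++ g2) F k ≡ Δ F (λ F₁ F₂ → ∑attach g1 F₁ (λ x → ∑attach g2 F₂ (λ y → k (x ++ y))))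
  ∑attach-++ [] g2 F k = sym (Δ-∑attach-[]ˡ F (λ x F₂ → ∑attach g2 F₂ (λ y → k (x ++ y))))
  ∑attach-++ (t ∷ g1) g2 F k = begin
      ∑attach (t ∷ (g1 ++ g2)) F k
    ≡⟨ ∑attach-∷ t (g1 ++ g2) F k ⟩
      Δ F (λ a b → ∑attachT t a (λ t' → ∑attach (g1 ++ g2) b (λ r → k (t' ∷ r))))
    ≡⟨ Δ-cong F (λ a b → ∑attachT-cong t a (λ t' → ∑attach-++ g1 g2 b (λ r → k (t' ∷ r)))) ⟩
      Δ F (λ a b → ∑attachT t a (λ t' → Δ b (λ b1 b2 → ∑attach g1 b1 (λ x → ∑attach g2 b2 (λ y → k (t' ∷ x ++ y))))))
    ≡⟨ Δ-cong F (λ a b → ∑-Δ (attachT t a) b (λ t' b1 b2 → ∑attach g1 b1 (λ x → ∑attach g2 b2 (λ y → k (t' ∷ x ++ y))))) ⟩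
      Δ²ʳ F (λ a b1 b2 → ∑attachT t a (λ t' → ∑attach g1 b1 (λ x → ∑attach g2 b2 (λ y → k (t' ∷ x ++ y)))))
    ≡⟨ Δ-coassoc F _ ⟩
      Δ²ˡ F (λ a b1 b2 → ∑attachT t a (λ t' → ∑attach g1 b1 (λ x → ∑attach g2 b2 (λ y → k (t' ∷ x ++ y)))))
    ≡⟨ Δ-cong F (λ F₁ F₂ → sym (∑attach-∷ t g1 F₁ (λ x → ∑attach g2 F₂ (λ y → k (x ++ y))))) ⟩
      Δ F (λ F₁ F₂ → ∑attach (t ∷ g1) F₁ (λ x → ∑attach g2 F₂ (λ y → k (x ++ y)))) ∎

  ∑attach-Δ : (f : Forest B) (F : List (Tree B)) (H : Forest B → Forest B → ℤ) →
    ∑attach f F (λ x → Δ x H) ≡ Δ f (λ f1 f2 → Δ F (λ F₁ F₂ → ∑attach f1 F₁ (λ x1 → ∑attach f2 F₂ (λ x2 → H x1 x2))))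
  ∑attach-Δ [] F H = sym (trans (Δ-[] (λ f1 f2 → Δ F (λ F₁ F₂ → ∑attach f1 F₁ (λ x1 → ∑attach f2 F₂ (λ x2 → H x1 x2)))))
                  (trans (Δ-∑attach-[]ˡ F (λ x1 F₂ → ∑attach [] F₂ (λ x2 → H x1 x2))) (base F)))
    where base : (F : List (Tree B)) → ∑attach [] F (λ x2 → H [] x2) ≡ ∑attach [] F (λ x → Δ x H)
          base [] = cong (_+ 0ℤ) (sym (Δ-[] H))
          base (_ ∷ _) = refl
  ∑attach-Δ (t ∷ f') F H = begin
      ∑attach (t ∷ f') F (λ x → Δ x H)
    ≡⟨ ∑attach-∷ t f' F _ ⟩
      Δ F (λ a b → ∑attachT t a (λ t' → ∑attach f' b (λ r → Δ (t' ∷ r) H)))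
    ≡⟨ Δ-cong F (λ a b → ∑attachT-cong t a (λ t' → trans (∑attach-cong f' b (λ r → Δ-∷ t' r H)) (∑attach-Δ f' b _))) ⟩
      Δ F (λ a b → ∑attachT t a (λ t' → Δ f' (λ f1 f2 → Δ b (λ b1 b2 → ∑attach f1 b1 (λ x1 → ∑attach f2 b2 (λ x2 → H (t' ∷ x1) x2 + H x1 (t' ∷ x2)))))))
    ≡⟨ Δ-cong F (λ a b → trans (∑-Δ (attachT t a) f' _) (Δ-cong f' (λ f1 f2 →
          trans (∑-Δ (attachT t a) b _) (Δ-cong b (λ b1 b2 → trans (∑attachT-cong t a (λ t' →
            trans (∑attach-cong f1 b1 (λ x1 → ∑-+ (attachF f2 b2) _ _)) (∑-+ (attachF f1 b1) _ _)))
            (∑-+ (attachT t a) _ _)))))) ⟩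
      Δ F (λ a b → Δ f' (λ f1 f2 → Δ b (λ b1 b2 →
          ∑attachT t a (λ t' → ∑attach f1 b1 (λ x1 → ∑attach f2 b2 (λ x2 → H (t' ∷ x1) x2)))
        + ∑attachT t a (λ t' → ∑attach f1 b1 (λ x1 → ∑attach f2 b2 (λ x2 → H x1 (t' ∷ x2)))))))
    ≡⟨ Δ-Δ F f' _ ⟩
      Δ f' (λ f1 f2 → Δ F (λ a b → Δ b (λ b1 b2 →
          ∑attachT t a (λ t' → ∑attach f1 b1 (λ x1 → ∑attach f2 b2 (λ x2 → H (t' ∷ x1) x2)))
        + ∑attachT t a (λ t' → ∑attach f1 b1 (λ x1 → ∑attach f2 b2 (λ x2 → H x1 (t' ∷ x2)))))))
    ≡⟨ Δ-cong f' (λ f1 f2 → trans (Δ-cong F (λ a b → Δ-+ b _ _)) (Δ-+ F _ _)) ⟩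
      Δ f' (λ f1 f2 → Δ²ʳ F (λ a b1 b2 → ∑attachT t a (λ t' → ∑attach f1 b1 (λ x1 → ∑attach f2 b2 (λ x2 → H (t' ∷ x1) x2))))
        + Δ²ʳ F (λ a b1 b2 → ∑attachT t a (λ t' → ∑attach f1 b1 (λ x1 → ∑attach f2 b2 (λ x2 → H x1 (t' ∷ x2))))))
    ≡⟨ Δ-cong f' (λ f1 f2 → cong₂ _+_ (t-goes-left f1 f2) (t-goes-right f1 f2)) ⟩
      Δ f' (λ f1 f2 → Δ F (λ F₁ F₂ → ∑attach (t ∷ f1) F₁ (λ x1 → ∑attach f2 F₂ (λ x2 → H x1 x2)))
                     + Δ F (λ F₁ F₂ → ∑attach f1 F₁ (λ x1 → ∑attach (t ∷ f2) F₂ (λ x2 → H x1 x2))))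
    ≡⟨ sym (Δ-∷ t f' _) ⟩
      Δ (t ∷ f') (λ f1 f2 → Δ F (λ F₁ F₂ → ∑attach f1 F₁ (λ x1 → ∑attach f2 F₂ (λ x2 → H x1 x2)))) ∎
    where
      t-goes-left : ∀ f1 f2 → Δ²ʳ F (λ a b1 b2 → ∑attachT t a (λ t' → ∑attach f1 b1 (λ x1 → ∑attach f2 b2 (λ x2 → H (t' ∷ x1) x2))))
                   ≡ Δ F (λ F₁ F₂ → ∑attach (t ∷ f1) F₁ (λ x1 → ∑attach f2 F₂ (λ x2 → H x1 x2)))
      t-goes-left f1 f2 = trans (Δ-coassoc F _) (Δ-cong F (λ F₁ F₂ → sym (∑attach-∷ t f1 F₁ _)))
      t-goes-right : ∀ f1 f2 → Δ²ʳ F (λ a b1 b2 → ∑attachT t a (λ t' → ∑attach f1 b1 (λ x1 → ∑attach f2 b2 (λ x2 → H x1 (t' ∷ x2)))))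
                   ≡ Δ F (λ F₁ F₂ → ∑attach f1 F₁ (λ x1 → ∑attach (t ∷ f2) F₂ (λ x2 → H x1 x2)))
      t-goes-right f1 f2 = begin
          Δ²ʳ F (λ a b1 b2 → ∑attachT t a (λ t' → ∑attach f1 b1 (λ x1 → ∑attach f2 b2 (λ x2 → H x1 (t' ∷ x2)))))
        ≡⟨ Δ²ʳ-cong F (λ a b1 b2 → ∑-comm (attachT t a) (attachF f1 b1) _) ⟩
          Δ²ʳ F (λ a b1 b2 → ∑attach f1 b1 (λ x1 → ∑attachT t a (λ t' → ∑attach f2 b2 (λ x2 → H x1 (t' ∷ x2)))))
        ≡⟨ Δ²ʳ-swap F _ ⟩
          Δ²ʳ F (λ F₁ a b2 → ∑attach f1 F₁ (λ x1 → ∑attachT t a (λ t' → ∑attach f2 b2 (λ x2 → H x1 (t' ∷ x2)))))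
        ≡⟨ Δ-cong F (λ F₁ F₂ → sym (trans (∑attach-cong f1 F₁ (λ x1 → ∑attach-∷ t f2 F₂ _)) (∑-Δ (attachF f1 F₁) F₂ _))) ⟩
          Δ F (λ F₁ F₂ → ∑attach f1 F₁ (λ x1 → ∑attach (t ∷ f2) F₂ (λ x2 → H x1 x2))) ∎

  ∑attach-zero : (g : Forest B) (F : List (Tree B)) → ∑attach g F (λ _ → 0ℤ) ≡ 0ℤ
  ∑attach-zero g F = ∑-zero (attachF g F)

  Δ-∑attach-Δ-++ : (G F : List (Tree B)) (W : List (Tree B) → List (Tree B) → List (Tree B) → List (Tree B) → ℤ) →
    Δ F (λ F₁ F₂ → ∑attach G F₂ (λ G′ → Δ F₁ (λ a₁ c₁ → Δ G′ (λ a₂ c₂ → W a₁ c₁ a₂ c₂))))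
      ≡ Δ G (λ p q → Δ⊗Δ F (λ a₁ c₁ u v → ∑attach p u (λ a₂ → ∑attach q v (λ c₂ → W a₁ c₁ a₂ c₂))))
  Δ-∑attach-Δ-++ G F W = begin
      Δ F (λ F₁ F₂ → ∑attach G F₂ (λ G′ → Δ F₁ (λ a₁ c₁ → Δ G′ (λ a₂ c₂ → W a₁ c₁ a₂ c₂))))
    ≡⟨ Δ-cong F (λ F₁ F₂ → ∑-Δ (attachF G F₂) F₁ _) ⟩
      Δ F (λ F₁ F₂ → Δ F₁ (λ a₁ c₁ → ∑attach G F₂ (λ G′ → Δ G′ (λ a₂ c₂ → W a₁ c₁ a₂ c₂))))
    ≡⟨ Δ-cong F (λ F₁ F₂ → Δ-cong F₁ (λ a₁ c₁ → ∑attach-Δ G F₂ (W a₁ c₁))) ⟩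
      Δ F (λ F₁ F₂ → Δ F₁ (λ a₁ c₁ → Δ G (λ p q → Δ F₂ (λ u v → ∑attach p u (λ a₂ → ∑attach q v (λ c₂ → W a₁ c₁ a₂ c₂))))))
    ≡⟨ Δ-cong F (λ F₁ F₂ → Δ-Δ F₁ G _) ⟩
      Δ F (λ F₁ F₂ → Δ G (λ p q → Δ F₁ (λ a₁ c₁ → Δ F₂ (λ u v → ∑attach p u (λ a₂ → ∑attach q v (λ c₂ → W a₁ c₁ a₂ c₂))))))
    ≡⟨ Δ-Δ F G _ ⟩
      Δ G (λ p q → Δ⊗Δ F (λ a₁ c₁ u v → ∑attach p u (λ a₂ → ∑attach q v (λ c₂ → W a₁ c₁ a₂ c₂)))) ∎

  mutual
    ∑attachT-assoc : (t : Tree B) (G F : List (Tree B)) (k : Tree B → ℤ) →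
      ∑attachT t G (λ g → ∑attachT g F k) ≡ Δ F (λ F₁ F₂ → ∑attach G F₂ (λ F₂' → ∑attachT t (F₁ ++ F₂') k))
    ∑attachT-assoc (node b cs) G F k = begin
        ∑attachT (node b cs) G (λ g → ∑attachT g F k)
      ≡⟨ ∑attachT-node b cs G _ ⟩
        Δ G (λ p q → ∑attach cs q (λ X → ∑attachT (node b (p ++ X)) F k))
      ≡⟨ Δ-cong G (λ p q → ∑attach-cong cs q (λ X → trans (∑attachT-node b (p ++ X) F k)
            (Δ-cong F (λ F₁ F₂ → ∑attach-++ p X F₂ (λ Y → k (node b (F₁ ++ Y))))))) ⟩
        Δ G (λ p q → ∑attach cs q (λ X → Δ F (λ F₁ F₂ → Δ F₂ (λ u v → ∑attach p u (λ y1 → ∑attach X v (λ y2 → K F₁ y1 y2))))))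
      ≡⟨ Δ-cong G (λ p q → trans (∑-Δ (attachF cs q) F _) (Δ-cong F (λ F₁ F₂ →
            trans (∑-Δ (attachF cs q) F₂ _) (Δ-cong F₂ (λ u v → ∑-comm (attachF cs q) (attachF p u) _))))) ⟩
        Δ G (λ p q → Δ F (λ F₁ F₂ → Δ F₂ (λ u v → ∑attach p u (λ y1 → ∑attach cs q (λ X → ∑attach X v (λ y2 → K F₁ y1 y2))))))
      ≡⟨ Δ-cong G (λ p q → Δ-cong F (λ F₁ F₂ → Δ-cong F₂ (λ u v → trans (∑attach-cong p u (λ y1 → ∑attach-assoc cs q v (λ y2 → K F₁ y1 y2)))
            (∑-Δ (attachF p u) v _)))) ⟩
        Δ G (λ p q → Δ³ʳ F (λ F₁ u v1 v2 → ∑attach p u (λ y1 → ∑attach q v2 (λ q' → ∑attach cs (v1 ++ q') (λ y2 → K F₁ y1 y2)))))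
      ≡⟨ Δ-cong G (λ p q → Δ³ʳ≡Δ⊗Δ F _) ⟩
        Δ G (λ p q → Δ⊗Δ F (λ a1 c1 u v → ∑attach p u (λ y1 → ∑attach q v (λ q' → ∑attach cs (c1 ++ q') (λ y2 → K a1 y1 y2)))))
      ≡⟨ Δ-cong G (λ p q → Δ⊗Δ-cong F (λ a1 c1 u v → ∑attach-cong p u (λ y1 → ∑attach-cong q v (λ q' → ∑attach-cong cs (c1 ++ q')
            (λ y2 → cong (λ z → k (node b z)) (sym (++-assoc a1 y1 y2))))))) ⟩
        Δ G (λ p q → Δ⊗Δ F (λ a1 c1 u v → ∑attach p u (λ a2 → ∑attach q v (λ c2 → V a1 c1 a2 c2))))
      ≡⟨ sym (Δ-∑attach-Δ-++ G F V) ⟩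
        Δ F (λ F₁ F₂ → ∑attach G F₂ (λ F₂' → Δ F₁ (λ a1 c1 → Δ F₂' (λ a2 c2 → V a1 c1 a2 c2))))
      ≡⟨ Δ-cong F (λ F₁ F₂ → ∑attach-cong G F₂ (λ F₂' → sym (trans (∑attachT-node b cs (F₁ ++ F₂') k) (Δ-++ F₁ F₂' _)))) ⟩
        Δ F (λ F₁ F₂ → ∑attach G F₂ (λ F₂' → ∑attachT (node b cs) (F₁ ++ F₂') k)) ∎
      where
        K : List (Tree B) → List (Tree B) → List (Tree B) → ℤ
        K F₁ y1 y2 = k (node b (F₁ ++ (y1 ++ y2)))
        V : List (Tree B) → List (Tree B) → List (Tree B) → List (Tree B) → ℤ
        V a1 c1 a2 c2 = ∑attach cs (c1 ++ c2) (λ X → k (node b ((a1 ++ a2) ++ X)))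

    -- Each tree of F lands either on a vertex of f (the part F₁) or on a
    -- vertex of a tree of G (the part F₂).
    ∑attach-assoc : (f G F : Forest B) (k : Forest B → ℤ) →
      ∑attach f G (λ g → ∑attach g F k) ≡ Δ F (λ F₁ F₂ → ∑attach G F₂ (λ F₂' → ∑attach f (F₁ ++ F₂') k))
    ∑attach-assoc [] [] F k = trans (∑attach-[]-[] (λ g → ∑attach g F k)) (trans (cong (λ z → ∑attach [] z k) (sym (++-identityʳ F)))
                          (sym (Δ-∑attach-[]ʳ F (λ F₁ F₂' → ∑attach [] (F₁ ++ F₂') k))))
    ∑attach-assoc [] (g ∷ G') F k = sym (trans (Δ-cong F (λ F₁ F₂ → trans (∑attach-∷ g G' F₂ _)
        (trans (Δ-cong F₂ (λ a b → trans (∑attachT-cong g a (λ t' → trans (∑attach-cong G' b (λ r → ∑attach-[]-nonempty F₁ t' r k)) (∑attach-zero G' b)))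
                                          (∑-zero (attachT g a)))) (Δ-zero F₂)))) (Δ-zero F))
    ∑attach-assoc (t ∷ f') G F k = begin
        ∑attach (t ∷ f') G (λ g → ∑attach g F k)
      ≡⟨ ∑attach-∷ t f' G _ ⟩
        Δ G (λ p q → ∑attachT t p (λ t' → ∑attach f' q (λ r → ∑attach (t' ∷ r) F k)))
      ≡⟨ Δ-cong G (λ p q → ∑attachT-cong t p (λ t' → ∑attach-cong f' q (λ r → ∑attach-∷ t' r F k))) ⟩
        Δ G (λ p q → ∑attachT t p (λ t' → ∑attach f' q (λ r → Δ F (λ a b → ∑attachT t' a (λ x → ∑attach r b (λ y → k (x ∷ y)))))))
      ≡⟨ Δ-cong G (λ p q → trans (∑attachT-cong t p (λ t' → trans (∑-Δ (attachF f' q) F _)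
            (Δ-cong F (λ a b → ∑-comm (attachF f' q) (attachT t' a) _)))) (∑-Δ (attachT t p) F _)) ⟩
        Δ G (λ p q → Δ F (λ a b → ∑attachT t p (λ t' → ∑attachT t' a (λ x → ∑attach f' q (λ r → ∑attach r b (λ y → k (x ∷ y)))))))
      ≡⟨ Δ-cong G (λ p q → Δ-cong F (λ a b → trans (∑attachT-cong t p (λ t' → ∑attachT-cong t' a (λ x → ∑attach-assoc f' q b (λ y → k (x ∷ y)))))
            (∑attachT-assoc t p a (λ x → Δ b (λ b1 b2 → ∑attach q b2 (λ q' → ∑attach f' (b1 ++ q') (λ y → k (x ∷ y)))))))) ⟩
        Δ G (λ p q → Δ F (λ a b → Δ a (λ a1 a2 → ∑attach p a2 (λ p' → ∑attachT t (a1 ++ p') (λ x → Δ b (λ b1 b2 → ∑attach q b2 (λ q' → ∑attach f' (b1 ++ q') (λ y → k (x ∷ y)))))))))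
      ≡⟨ Δ-cong G (λ p q → Δ-cong F (λ a b → Δ-cong a (λ a1 a2 → trans (∑attach-cong p a2 (λ p' → ∑-Δ (attachT t (a1 ++ p')) b _))
            (∑-Δ (attachF p a2) b _)))) ⟩
        Δ G (λ p q → Δ⊗Δ F (λ a1 a2 b1 b2 → ∑attach p a2 (λ p' → ∑attachT t (a1 ++ p') (λ x → ∑attach q b2 (λ q' → ∑attach f' (b1 ++ q') (λ y → k (x ∷ y)))))))
      ≡⟨ Δ-cong G (λ p q → Δ⊗Δ-interchange F _) ⟩
        Δ G (λ p q → Δ⊗Δ F (λ a1 b1 a2 b2 → ∑attach p a2 (λ p' → ∑attachT t (a1 ++ p') (λ x → ∑attach q b2 (λ q' → ∑attach f' (b1 ++ q') (λ y → k (x ∷ y)))))))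
      ≡⟨ Δ-cong G (λ p q → Δ⊗Δ-cong F (λ a1 b1 u v → ∑attach-cong p u (λ a2 → ∑-comm (attachT t (a1 ++ a2)) (attachF q v) _))) ⟩
        Δ G (λ p q → Δ⊗Δ F (λ a1 b1 u v → ∑attach p u (λ a2 → ∑attach q v (λ b2 → W a1 b1 a2 b2))))
      ≡⟨ sym (Δ-∑attach-Δ-++ G F W) ⟩
        Δ F (λ F₁ F₂ → ∑attach G F₂ (λ F₂' → Δ F₁ (λ a1 b1 → Δ F₂' (λ a2 b2 → W a1 b1 a2 b2))))
      ≡⟨ Δ-cong F (λ F₁ F₂ → ∑attach-cong G F₂ (λ F₂' → sym (trans (∑attach-∷ t f' (F₁ ++ F₂') k) (Δ-++ F₁ F₂' _)))) ⟩
        Δ F (λ F₁ F₂ → ∑attach G F₂ (λ F₂' → ∑attach (t ∷ f') (F₁ ++ F₂') k)) ∎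
      where
        W : List (Tree B) → List (Tree B) → List (Tree B) → List (Tree B) → ℤ
        W a1 b1 a2 b2 = ∑attachT t (a1 ++ a2) (λ x → ∑attach f' (b1 ++ b2) (λ y → k (x ∷ y)))

-- Left grafting is attaching

module _ {B : Set} where
  ∑graft : Tree B → Forest B → (Forest B → ℤ) → ℤ
  ∑graft τ P k = ∑ (graftF τ P) k

  ∑graftT : Tree B → Tree B → (Tree B → ℤ) → ℤ
  ∑graftT τ t k = ∑ (graftT τ t) k

  ∑graft-cong : (τ : Tree B) (P : Forest B) {f g : Forest B → ℤ} → (∀ x → f x ≡ g x) → ∑graft τ P f ≡ ∑graft τ P g
  ∑graft-cong τ P e = ∑-cong (graftF τ P) e

  ∑graftT-node : (τ : Tree B) (a : B) (cs : Forest B) (k : Tree B → ℤ) →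
    ∑graftT τ (node a cs) k ≡ k (node a (τ ∷ cs)) + ∑graft τ cs (λ X → k (node a X))
  ∑graftT-node τ a cs k = cong (k (node a (τ ∷ cs)) +_) (∑-map (node a) (graftF τ cs) k)

  ∑graft-∷ : (τ t : Tree B) (P : Forest B) (k : Forest B → ℤ) →
    ∑graft τ (t ∷ P) k ≡ ∑graftT τ t (λ t' → k (t' ∷ P)) + ∑graft τ P (λ ω → k (t ∷ ω))
  ∑graft-∷ τ t P k = trans (∑-++ (map (_∷ P) (graftT τ t)) _ k) (cong₂ _+_ (∑-map _ (graftT τ t) k) (∑-map _ (graftF τ P) k))

  ∑graft-++ : (τ : Tree B) (p X : Forest B) (k : Forest B → ℤ) →
    ∑graft τ (p ++ X) k ≡ ∑graft τ p (λ p' → k (p' ++ X)) + ∑graft τ X (λ c' → k (p ++ c'))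
  ∑graft-++ τ [] X k = sym (+-identityˡ _)
  ∑graft-++ τ (t ∷ p) X k = begin
      ∑graft τ (t ∷ (p ++ X)) k
    ≡⟨ ∑graft-∷ τ t (p ++ X) k ⟩
      ∑graftT τ t (λ t' → k (t' ∷ p ++ X)) + ∑graft τ (p ++ X) (λ ω → k (t ∷ ω))
    ≡⟨ cong (∑graftT τ t (λ t' → k (t' ∷ p ++ X)) +_) (∑graft-++ τ p X (λ ω → k (t ∷ ω))) ⟩
      ∑graftT τ t (λ t' → k (t' ∷ p ++ X)) + (∑graft τ p (λ p' → k (t ∷ p' ++ X)) + ∑graft τ X (λ c' → k (t ∷ p ++ c')))
    ≡⟨ regroup (∑graftT τ t (λ t' → k (t' ∷ p ++ X))) (∑graft τ p (λ p' → k (t ∷ p' ++ X))) (∑graft τ X (λ c' → k (t ∷ p ++ c'))) ⟩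
      (∑graftT τ t (λ t' → k (t' ∷ p ++ X)) + ∑graft τ p (λ p' → k (t ∷ p' ++ X))) + ∑graft τ X (λ c' → k (t ∷ p ++ c'))
    ≡⟨ cong (_+ ∑graft τ X (λ c' → k (t ∷ p ++ c'))) (sym (∑graft-∷ τ t p (λ p' → k (p' ++ X)))) ⟩
      ∑graft τ (t ∷ p) (λ p' → k (p' ++ X)) + ∑graft τ X (λ c' → k (t ∷ p ++ c')) ∎
    where regroup : ∀ a b c → a + (b + c) ≡ (a + b) + c
          regroup = solve-∀

  ∑graft-Δ : (τ : Tree B) (P : Forest B) (H : Forest B → Forest B → ℤ) →
    ∑graft τ P (λ ω → Δ ω H) ≡ Δ P (λ p q → ∑graft τ p (λ p' → H p' q) + ∑graft τ q (λ q' → H p q'))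
  ∑graft-Δ τ [] H = refl
  ∑graft-Δ τ (t ∷ P) H = begin
      ∑graft τ (t ∷ P) (λ ω → Δ ω H)
    ≡⟨ ∑graft-∷ τ t P _ ⟩
      ∑graftT τ t (λ t' → Δ (t' ∷ P) H) + ∑graft τ P (λ ω → Δ (t ∷ ω) H)
    ≡⟨ cong₂ _+_ (trans (∑-cong (graftT τ t) (λ t' → Δ-∷ t' P H)) (∑-Δ (graftT τ t) P _))
                 (trans (∑graft-cong τ P (λ ω → Δ-∷ t ω H)) (∑graft-Δ τ P _)) ⟩
      Δ P (λ a b → ∑graftT τ t (λ t' → H (t' ∷ a) b + H a (t' ∷ b)))
        + Δ P (λ p q → ∑graft τ p (λ p' → H (t ∷ p') q + H p' (t ∷ q)) + ∑graft τ q (λ q' → H (t ∷ p) q' + H p (t ∷ q')))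
    ≡⟨ sym (Δ-+ P _ _) ⟩
      Δ P (λ p q → ∑graftT τ t (λ t' → H (t' ∷ p) q + H p (t' ∷ q))
        + (∑graft τ p (λ p' → H (t ∷ p') q + H p' (t ∷ q)) + ∑graft τ q (λ q' → H (t ∷ p) q' + H p (t ∷ q'))))
    ≡⟨ Δ-cong P pw ⟩
      Δ P (λ p q → (∑graft τ (t ∷ p) (λ p' → H p' q) + ∑graft τ q (λ q' → H (t ∷ p) q'))
                  + (∑graft τ p (λ p' → H p' (t ∷ q)) + ∑graft τ (t ∷ q) (λ q' → H p q')))
    ≡⟨ sym (Δ-∷ t P _) ⟩
      Δ (t ∷ P) (λ p q → ∑graft τ p (λ p' → H p' q) + ∑graft τ q (λ q' → H p q')) ∎
    where
      regroup : ∀ a1 a2 b1 b2 c1 c2 → (a1 + a2) + ((b1 + b2) + (c1 + c2)) ≡ ((a1 + b1) + c1) + (b2 + (a2 + c2))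
      regroup = solve-∀
      pw : ∀ p q → ∑graftT τ t (λ t' → H (t' ∷ p) q + H p (t' ∷ q))
                   + (∑graft τ p (λ p' → H (t ∷ p') q + H p' (t ∷ q)) + ∑graft τ q (λ q' → H (t ∷ p) q' + H p (t ∷ q')))
                 ≡ (∑graft τ (t ∷ p) (λ p' → H p' q) + ∑graft τ q (λ q' → H (t ∷ p) q'))
                   + (∑graft τ p (λ p' → H p' (t ∷ q)) + ∑graft τ (t ∷ q) (λ q' → H p q'))
      pw p q = begin
          ∑graftT τ t (λ t' → H (t' ∷ p) q + H p (t' ∷ q))
            + (∑graft τ p (λ p' → H (t ∷ p') q + H p' (t ∷ q)) + ∑graft τ q (λ q' → H (t ∷ p) q' + H p (t ∷ q')))
        ≡⟨ cong₂ _+_ (∑-+ (graftT τ t) _ _) (cong₂ _+_ (∑-+ (graftF τ p) _ _) (∑-+ (graftF τ q) _ _)) ⟩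
          (∑graftT τ t (λ t' → H (t' ∷ p) q) + ∑graftT τ t (λ t' → H p (t' ∷ q)))
            + ((∑graft τ p (λ p' → H (t ∷ p') q) + ∑graft τ p (λ p' → H p' (t ∷ q)))
              + (∑graft τ q (λ q' → H (t ∷ p) q') + ∑graft τ q (λ q' → H p (t ∷ q'))))
        ≡⟨ regroup (∑graftT τ t (λ t' → H (t' ∷ p) q)) (∑graftT τ t (λ t' → H p (t' ∷ q))) (∑graft τ p (λ p' → H (t ∷ p') q)) (∑graft τ p (λ p' → H p' (t ∷ q))) (∑graft τ q (λ q' → H (t ∷ p) q')) (∑graft τ q (λ q' → H p (t ∷ q'))) ⟩
          ((∑graftT τ t (λ t' → H (t' ∷ p) q) + ∑graft τ p (λ p' → H (t ∷ p') q)) + ∑graft τ q (λ q' → H (t ∷ p) q'))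
            + (∑graft τ p (λ p' → H p' (t ∷ q)) + (∑graftT τ t (λ t' → H p (t' ∷ q)) + ∑graft τ q (λ q' → H p (t ∷ q'))))
        ≡⟨ cong₂ (λ u v → (u + ∑graft τ q (λ q' → H (t ∷ p) q')) + (∑graft τ p (λ p' → H p' (t ∷ q)) + v))
             (sym (∑graft-∷ τ t p (λ p' → H p' q))) (sym (∑graft-∷ τ t q (λ q' → H p q'))) ⟩
          (∑graft τ (t ∷ p) (λ p' → H p' q) + ∑graft τ q (λ q' → H (t ∷ p) q'))
            + (∑graft τ p (λ p' → H p' (t ∷ q)) + ∑graft τ (t ∷ q) (λ q' → H p q')) ∎

  mutual
    ∑attachT-graft : (τ g : Tree B) (P : List (Tree B)) (h : Tree B → ℤ) →
      ∑attachT g P (λ x → ∑graftT τ x h) ≡ ∑attachT g (τ ∷ P) h + ∑graft τ P (λ ω → ∑attachT g ω h)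
    ∑attachT-graft τ (node b cs) P h = begin
        ∑attachT (node b cs) P (λ x → ∑graftT τ x h)
      ≡⟨ ∑attachT-node b cs P _ ⟩
        Δ P (λ p q → ∑attach cs q (λ cs' → ∑graftT τ (node b (p ++ cs')) h))
      ≡⟨ Δ-cong P pw ⟩
        Δ P (λ p q → (A1 p q + A3 p q) + (A2 p q + A4 p q))
      ≡⟨ Δ-+ P _ _ ⟩
        Δ P (λ p q → A1 p q + A3 p q) + Δ P (λ p q → A2 p q + A4 p q)
      ≡⟨ cong₂ _+_ (sym (trans (∑attachT-node b cs (τ ∷ P) h) (Δ-∷ τ P _)))
                   (sym (trans (∑graft-cong τ P (λ ω → ∑attachT-node b cs ω h)) (∑graft-Δ τ P _))) ⟩
        ∑attachT (node b cs) (τ ∷ P) h + ∑graft τ P (λ ω → ∑attachT (node b cs) ω h) ∎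
      where
        A1 A2 A3 A4 : List (Tree B) → List (Tree B) → ℤ
        A1 p q = ∑attach cs q (λ cs' → h (node b (τ ∷ p ++ cs')))
        A2 p q = ∑graft τ p (λ p' → ∑attach cs q (λ cs' → h (node b (p' ++ cs'))))
        A3 p q = ∑attach cs (τ ∷ q) (λ c' → h (node b (p ++ c')))
        A4 p q = ∑graft τ q (λ ω → ∑attach cs ω (λ c' → h (node b (p ++ c'))))
        regroup : ∀ a b c d → a + (b + (c + d)) ≡ (a + c) + (b + d)
        regroup = solve-∀
        pw : ∀ p q → ∑attach cs q (λ cs' → ∑graftT τ (node b (p ++ cs')) h) ≡ (A1 p q + A3 p q) + (A2 p q + A4 p q)
        pw p q = begin
            ∑attach cs q (λ cs' → ∑graftT τ (node b (p ++ cs')) h)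
          ≡⟨ ∑attach-cong cs q (λ cs' → trans (∑graftT-node τ b (p ++ cs') h) (cong (h (node b (τ ∷ p ++ cs')) +_) (∑graft-++ τ p cs' _))) ⟩
            ∑attach cs q (λ cs' → h (node b (τ ∷ p ++ cs')) + (∑graft τ p (λ p' → h (node b (p' ++ cs'))) + ∑graft τ cs' (λ c' → h (node b (p ++ c')))))
          ≡⟨ trans (∑-+ (attachF cs q) _ _) (cong (A1 p q +_) (∑-+ (attachF cs q) _ _)) ⟩
            A1 p q + (∑attach cs q (λ cs' → ∑graft τ p (λ p' → h (node b (p' ++ cs')))) + ∑attach cs q (λ cs' → ∑graft τ cs' (λ c' → h (node b (p ++ c')))))
          ≡⟨ cong (A1 p q +_) (cong₂ _+_ (∑-comm (attachF cs q) (graftF τ p) _) (∑attach-graft τ cs q (λ c' → h (node b (p ++ c'))))) ⟩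
            A1 p q + (A2 p q + (A3 p q + A4 p q))
          ≡⟨ regroup (A1 p q) (A2 p q) (A3 p q) (A4 p q) ⟩
            (A1 p q + A3 p q) + (A2 p q + A4 p q) ∎

    -- τ lands either on a vertex of G, leftmost there, or on a vertex of a
    -- tree of P.
    ∑attach-graft : (τ : Tree B) (G : Forest B) (P : List (Tree B)) (h : Forest B → ℤ) →
      ∑attach G P (λ ω → ∑graft τ ω h) ≡ ∑attach G (τ ∷ P) h + ∑graft τ P (λ ω → ∑attach G ω h)
    ∑attach-graft τ [] [] h = refl
    ∑attach-graft τ [] (t ∷ P) h = sym (trans (+-identityˡ _) (trans (∑graft-∷ τ t P _)
                          (cong₂ _+_ (∑-zero (graftT τ t)) (∑-zero (graftF τ P)))))
    ∑attach-graft τ (t ∷ ts) P h = begin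
        ∑attach (t ∷ ts) P (λ ω → ∑graft τ ω h)
      ≡⟨ ∑attach-∷ t ts P _ ⟩
        Δ P (λ a b → ∑attachT t a (λ t' → ∑attach ts b (λ r → ∑graft τ (t' ∷ r) h)))
      ≡⟨ Δ-cong P pw ⟩
        Δ P (λ a b → (B1 a b + B3 a b) + (B2 a b + B4 a b))
      ≡⟨ Δ-+ P _ _ ⟩
        Δ P (λ a b → B1 a b + B3 a b) + Δ P (λ a b → B2 a b + B4 a b)
      ≡⟨ cong₂ _+_ (sym (trans (∑attach-∷ t ts (τ ∷ P) h) (Δ-∷ τ P _)))
                   (sym (trans (∑graft-cong τ P (λ ω → ∑attach-∷ t ts ω h)) (∑graft-Δ τ P _))) ⟩
        ∑attach (t ∷ ts) (τ ∷ P) h + ∑graft τ P (λ ω → ∑attach (t ∷ ts) ω h) ∎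
      where
        k1 : List (Tree B) → Tree B → ℤ
        k1 b x = ∑attach ts b (λ r → h (x ∷ r))
        B1 B2 B3 B4 : List (Tree B) → List (Tree B) → ℤ
        B1 a b = ∑attachT t (τ ∷ a) (k1 b)
        B2 a b = ∑graft τ a (λ ω → ∑attachT t ω (k1 b))
        B3 a b = ∑attachT t a (λ t' → ∑attach ts (τ ∷ b) (λ r → h (t' ∷ r)))
        B4 a b = ∑graft τ b (λ ω → ∑attachT t a (λ t' → ∑attach ts ω (λ r → h (t' ∷ r))))
        regroup : ∀ a b c d → (a + b) + (c + d) ≡ (a + c) + (b + d)
        regroup = solve-∀
        pw : ∀ a b → ∑attachT t a (λ t' → ∑attach ts b (λ r → ∑graft τ (t' ∷ r) h)) ≡ (B1 a b + B3 a b) + (B2 a b + B4 a b)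
        pw a b = begin
            ∑attachT t a (λ t' → ∑attach ts b (λ r → ∑graft τ (t' ∷ r) h))
          ≡⟨ ∑attachT-cong t a (λ t' → trans (∑attach-cong ts b (λ r → ∑graft-∷ τ t' r h)) (∑-+ (attachF ts b) _ _)) ⟩
            ∑attachT t a (λ t' → ∑attach ts b (λ r → ∑graftT τ t' (λ x → h (x ∷ r))) + ∑attach ts b (λ r → ∑graft τ r (λ r' → h (t' ∷ r'))))
          ≡⟨ ∑-+ (attachT t a) _ _ ⟩
            ∑attachT t a (λ t' → ∑attach ts b (λ r → ∑graftT τ t' (λ x → h (x ∷ r)))) + ∑attachT t a (λ t' → ∑attach ts b (λ r → ∑graft τ r (λ r' → h (t' ∷ r'))))
          ≡⟨ cong₂ _+_ (trans (∑attachT-cong t a (λ t' → ∑-comm (attachF ts b) (graftT τ t') _)) (∑attachT-graft τ t a (k1 b)))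
                       (trans (∑attachT-cong t a (λ t' → ∑attach-graft τ ts b (λ r' → h (t' ∷ r'))))
                         (trans (∑-+ (attachT t a) _ _) (cong (B3 a b +_) (∑-comm (attachT t a) (graftF τ b) _)))) ⟩
            (B1 a b + B2 a b) + (B3 a b + B4 a b)
          ≡⟨ regroup (B1 a b) (B2 a b) (B3 a b) (B4 a b) ⟩
            (B1 a b + B3 a b) + (B2 a b + B4 a b) ∎

  -- Grafting preserves the number of trees; this keeps the fuel of graftFuel exact.
  ∑graft-cong-length : (τ : Tree B) (P : Forest B) {f g : Forest B → ℤ} →
    (∀ ω → length ω ≡ length P → f ω ≡ g ω) → ∑graft τ P f ≡ ∑graft τ P g
  ∑graft-cong-length τ [] e = refl
  ∑graft-cong-length τ (t ∷ P) {f} {g} e = begin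
      ∑graft τ (t ∷ P) f
    ≡⟨ ∑graft-∷ τ t P f ⟩
      ∑graftT τ t (λ t' → f (t' ∷ P)) + ∑graft τ P (λ ω → f (t ∷ ω))
    ≡⟨ cong₂ _+_ (∑-cong (graftT τ t) (λ t' → e (t' ∷ P) refl)) (∑graft-cong-length τ P (λ ω eq → e (t ∷ ω) (cong suc eq))) ⟩
      ∑graftT τ t (λ t' → g (t' ∷ P)) + ∑graft τ P (λ ω → g (t ∷ ω))
    ≡⟨ sym (∑graft-∷ τ t P g) ⟩
      ∑graft τ (t ∷ P) g ∎

  ⟦graftFuel⟧ : (k : ℕ) (P G : Forest B) → length P ≡ k → (h : Forest B → ℤ) → ⟦ graftFuel k P G ⟧ h ≡ ∑attach G P h
  ⟦graftFuel⟧ zero [] G refl h = trans (⟦⟧-single G h) (sym (∑attach-[]ʳ G h))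
  ⟦graftFuel⟧ (suc k) (τ ∷ P) G eq h = begin
      ⟦ linmap (treeOnto τ) (graftFuel k P G) ++ neg (linmap (λ ω → graftFuel k ω G) (treeOnto τ P)) ⟧ h
    ≡⟨ trans (⟦⟧-++ (linmap (treeOnto τ) (graftFuel k P G)) (neg (linmap (λ ω → graftFuel k ω G) (treeOnto τ P))) h) (cong₂ _+_ (⟦⟧-linmap (treeOnto τ) (graftFuel k P G) h)
                                      (trans (⟦⟧-neg (linmap (λ ω → graftFuel k ω G) (treeOnto τ P)) h) (cong -_ (⟦⟧-linmap (λ ω → graftFuel k ω G) (treeOnto τ P) h)))) ⟩
      ⟦ graftFuel k P G ⟧ (λ ω → ⟦ treeOnto τ ω ⟧ h) + - ⟦ treeOnto τ P ⟧ (λ ω → ⟦ graftFuel k ω G ⟧ h)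
    ≡⟨ cong₂ (λ u v → u + - v) (trans (⟦⟧-cong (graftFuel k P G) (λ ω → ⟦⟧-basis (graftF τ ω) h)) (⟦graftFuel⟧ k P G eq' _))
                               (trans (⟦⟧-basis (graftF τ P) _) (∑graft-cong-length τ P (λ ω e → ⟦graftFuel⟧ k ω G (trans e eq') h))) ⟩
      ∑attach G P (λ ω → ∑graft τ ω h) + - ∑graft τ P (λ ω → ∑attach G ω h)
    ≡⟨ cong (_+ - ∑graft τ P (λ ω → ∑attach G ω h)) (∑attach-graft τ G P h) ⟩
      (∑attach G (τ ∷ P) h + ∑graft τ P (λ ω → ∑attach G ω h)) + - ∑graft τ P (λ ω → ∑attach G ω h)
    ≡⟨ regroup (∑attach G (τ ∷ P) h) (∑graft τ P (λ ω → ∑attach G ω h)) ⟩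
      ∑attach G (τ ∷ P) h ∎
    where
      eq' : length P ≡ k
      eq' = suc-injective eq
      regroup : ∀ a b → (a + b) + - b ≡ a
      regroup = solve-∀

  ⟦▷⟧ : (P G : Forest B) (h : Forest B → ℤ) → ⟦ P ▷ G ⟧ h ≡ ∑attach G P h
  ⟦▷⟧ P G h = ⟦graftFuel⟧ (length P) P G refl h

-- Primitive elements and Lie polynomials

-- Δ L = L ⊗ 1 + 1 ⊗ L.
Primitive : {B : Set} → Lin (Forest B) → Set
Primitive {B} L = (H : Forest B → Forest B → ℤ) → ⟦ L ⟧ (λ x → Δ x H) ≡ ⟦ L ⟧ (λ x → H x [] + H [] x)

-- L has no component on the empty forest.
IgnoresEmpty : {B : Set} → Lin (Forest B) → Set
IgnoresEmpty {B} L = (k1 k2 : Forest B → ℤ) → (∀ t ts → k1 (t ∷ ts) ≡ k2 (t ∷ ts)) → ⟦ L ⟧ k1 ≡ ⟦ L ⟧ k2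

module _ {C : Set} where
  ⟦⟧-commutator : (A B : Lin (Forest C)) (k : Forest C → ℤ) →
    ⟦ concatL A B ++ neg (concatL B A) ⟧ k
      ≡ ⟦ A ⟧ (λ x → ⟦ B ⟧ (λ y → k (x ++ y))) + - ⟦ A ⟧ (λ x → ⟦ B ⟧ (λ y → k (y ++ x)))
  ⟦⟧-commutator A B k = trans (⟦⟧-++ (concatL A B) (neg (concatL B A)) k)
    (cong₂ _+_ (⟦⟧-concatL A B k)
      (trans (⟦⟧-neg (concatL B A) k) (cong -_ (trans (⟦⟧-concatL B A k) (⟦⟧-comm B A _)))))

  -- Δ (x y) = Δ x · Δ y, which for primitive x and y is x y ⊗ 1 + x ⊗ y + y ⊗ x + 1 ⊗ x y.
  ⟦⟧-Δ-concat : (A B : Lin (Forest C)) → Primitive A → Primitive B → (H : Forest C → Forest C → ℤ) →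
    ⟦ A ⟧ (λ x → ⟦ B ⟧ (λ y → Δ (x ++ y) H))
      ≡ ⟦ A ⟧ (λ x → ⟦ B ⟧ (λ y → (H (x ++ y) [] + H x y) + (H y x + H [] (x ++ y))))
  ⟦⟧-Δ-concat A B A-primitive B-primitive H = begin
      ⟦ A ⟧ (λ x → ⟦ B ⟧ (λ y → Δ (x ++ y) H))
    ≡⟨ ⟦⟧-cong A (λ x → trans (⟦⟧-cong B (λ y → Δ-++ x y H)) (⟦⟧-Δ B x _)) ⟩
      ⟦ A ⟧ (λ x → Δ x (λ x₁ x₂ → ⟦ B ⟧ (λ y → Δ y (λ y₁ y₂ → H (x₁ ++ y₁) (x₂ ++ y₂)))))
    ≡⟨ A-primitive _ ⟩
      ⟦ A ⟧ (λ x → ⟦ B ⟧ (λ y → Δ y (λ y₁ y₂ → H (x ++ y₁) y₂)) + ⟦ B ⟧ (λ y → Δ y (λ y₁ y₂ → H y₁ (x ++ y₂))))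
    ≡⟨ ⟦⟧-cong A (λ x → cong₂ _+_ (B-primitive _) (B-primitive _)) ⟩
      ⟦ A ⟧ (λ x → ⟦ B ⟧ (λ y → H (x ++ y) [] + H (x ++ []) y) + ⟦ B ⟧ (λ y → H y (x ++ []) + H [] (x ++ y)))
    ≡⟨ ⟦⟧-cong A (λ x → trans (sym (⟦⟧-+ B _ _)) (⟦⟧-cong B (λ y →
          cong₂ (λ u v → (H (x ++ y) [] + H u y) + (H y v + H [] (x ++ y))) (++-identityʳ x) (++-identityʳ x)))) ⟩
      ⟦ A ⟧ (λ x → ⟦ B ⟧ (λ y → (H (x ++ y) [] + H x y) + (H y x + H [] (x ++ y)))) ∎

  primitive-commutator : (A B : Lin (Forest C)) → Primitive A → Primitive B → Primitive (concatL A B ++ neg (concatL B A))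
  primitive-commutator A B A-primitive B-primitive H = begin
      ⟦ concatL A B ++ neg (concatL B A) ⟧ (λ z → Δ z H)
    ≡⟨ ⟦⟧-commutator A B _ ⟩
      ⟦ A ⟧ (λ x → ⟦ B ⟧ (λ y → Δ (x ++ y) H)) + - ⟦ A ⟧ (λ x → ⟦ B ⟧ (λ y → Δ (y ++ x) H))
    ≡⟨ cong₂ (λ u v → u + - v) (⟦⟧-Δ-concat A B A-primitive B-primitive H)
         (trans (⟦⟧-comm A B _) (trans (⟦⟧-Δ-concat B A B-primitive A-primitive H) (⟦⟧-comm B A _))) ⟩
      D (λ x y → (P x y + Q x y) + (R x y + S x y)) + - D (λ x y → (P′ x y + R x y) + (Q x y + S′ x y))
    ≡⟨ cong₂ (λ u v → u + - v) (trans (D-+ _ _) (cong₂ _+_ (D-+ P Q) (D-+ R S))) (trans (D-+ _ _) (cong₂ _+_ (D-+ P′ R) (D-+ Q S′))) ⟩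
      ((D P + D Q) + (D R + D S)) + - ((D P′ + D R) + (D Q + D S′))
    ≡⟨ cancel (D P) (D Q) (D R) (D S) (D P′) (D S′) ⟩
      (D P + D S) + - (D P′ + D S′)
    ≡⟨ sym (cong₂ (λ u v → u + - v) (D-+ P S) (D-+ P′ S′)) ⟩
      D (λ x y → P x y + S x y) + - D (λ x y → P′ x y + S′ x y)
    ≡⟨ sym (⟦⟧-commutator A B _) ⟩
      ⟦ concatL A B ++ neg (concatL B A) ⟧ (λ z → H z [] + H [] z) ∎
    where
      D : (Forest C → Forest C → ℤ) → ℤ
      D f = ⟦ A ⟧ (λ x → ⟦ B ⟧ (λ y → f x y))
      D-+ : (f g : Forest C → Forest C → ℤ) → D (λ x y → f x y + g x y) ≡ D f + D g
      D-+ f g = trans (⟦⟧-cong A (λ x → ⟦⟧-+ B _ _)) (⟦⟧-+ A _ _)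
      P Q R S P′ S′ : Forest C → Forest C → ℤ
      P x y = H (x ++ y) []
      Q x y = H x y
      R x y = H y x
      S x y = H [] (x ++ y)
      P′ x y = H (y ++ x) []
      S′ x y = H [] (y ++ x)
      cancel : ∀ p q r s p′ s′ → ((p + q) + (r + s)) + - ((p′ + r) + (q + s′)) ≡ (p + s) + - (p′ + s′)
      cancel = solve-∀

  ignoresEmpty-commutator : (A B : Lin (Forest C)) → IgnoresEmpty A → IgnoresEmpty B →
    IgnoresEmpty (concatL A B ++ neg (concatL B A))
  ignoresEmpty-commutator A B A-ignores B-ignores k₁ k₂ e = trans (⟦⟧-commutator A B k₁) (trans (cong₂ (λ u v → u + - v)
      (A-ignores _ _ (λ u us → ⟦⟧-cong B (λ y → e u (us ++ y))))
      (⟦⟧-cong A (λ x → B-ignores _ _ (λ u us → e u (us ++ x))))) (sym (⟦⟧-commutator A B k₂)))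

  primitive-tree : (t : Tree C) → Primitive ((1ℤ , t ∷ []) ∷ [])
  primitive-tree t H = trans (⟦⟧-single (t ∷ []) (λ x → Δ x H)) (trans (Δ-∷ t [] H)
    (trans (Δ-[] (λ a b → H (t ∷ a) b + H a (t ∷ b))) (sym (⟦⟧-single (t ∷ []) (λ x → H x [] + H [] x)))))

  primitive-interp : (t : LieTerm C) → Primitive (interp t)
  primitive-interp (gen t) = primitive-tree t
  primitive-interp (br a b) = primitive-commutator (interp a) (interp b) (primitive-interp a) (primitive-interp b)

  ignoresEmpty-interp : (t : LieTerm C) → IgnoresEmpty (interp t)
  ignoresEmpty-interp (gen t) k₁ k₂ e = trans (⟦⟧-single (t ∷ []) k₁) (trans (e t []) (sym (⟦⟧-single (t ∷ []) k₂)))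
  ignoresEmpty-interp (br a b) = ignoresEmpty-commutator (interp a) (interp b) (ignoresEmpty-interp a) (ignoresEmpty-interp b)

  primitive-interpL : (L : Lin (LieTerm C)) → Primitive (interpL L)
  primitive-interpL L H = trans (⟦⟧-linmap interp L _) (trans (⟦⟧-cong L (λ t → primitive-interp t H)) (sym (⟦⟧-linmap interp L _)))

  ignoresEmpty-interpL : (L : Lin (LieTerm C)) → IgnoresEmpty (interpL L)
  ignoresEmpty-interpL L k₁ k₂ e = trans (⟦⟧-linmap interp L _) (trans (⟦⟧-cong L (λ t → ignoresEmpty-interp t k₁ k₂ e)) (sym (⟦⟧-linmap interp L _)))

module _ {C D : Set} where
  Δ-relabel : (g : C → D) (x : Forest C) (H : Forest D → Forest D → ℤ) →
    Δ (relabelF g x) H ≡ Δ x (λ a b → H (relabelF g a) (relabelF g b))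
  Δ-relabel g [] H = refl
  Δ-relabel g (t ∷ x) H = trans (Δ-∷ (relabelT g t) (relabelF g x) H)
    (trans (Δ-relabel g x _) (sym (Δ-∷ t x _)))

  ⟦⟧-relabelL : (g : C → D) (M : Lin (Forest C)) (k : Forest D → ℤ) → ⟦ relabelL g M ⟧ k ≡ ⟦ M ⟧ (λ x → k (relabelF g x))
  ⟦⟧-relabelL g M k = ∑-map _ M _

  primitive-relabelL : (g : C → D) (M : Lin (Forest C)) → Primitive M → Primitive (relabelL g M)
  primitive-relabelL g M M-primitive H = trans (⟦⟧-relabelL g M _) (trans (⟦⟧-cong M (λ x → Δ-relabel g x H))
    (trans (M-primitive _) (sym (⟦⟧-relabelL g M _))))

  ignoresEmpty-relabelL : (g : C → D) (M : Lin (Forest C)) → IgnoresEmpty M → IgnoresEmpty (relabelL g M)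
  ignoresEmpty-relabelL g M M-ignores k₁ k₂ e = trans (⟦⟧-relabelL g M k₁)
    (trans (M-ignores _ _ (λ t ts → e (relabelT g t) (relabelF g ts))) (sym (⟦⟧-relabelL g M k₂)))

-- Substitution

module Substitution {n : ℕ} {B : Set} (σ : Fin n → Lin (Forest B))
  (σ-primitive : ∀ i → Primitive (σ i)) (σ-ignoresEmpty : ∀ i → IgnoresEmpty (σ i)) where
  Φ : Forest (Fin n) → (Forest B → ℤ) → ℤ
  Φ P k = ⟦ substFL σ P ⟧ k

  ΦT : Tree (Fin n) → (Forest B → ℤ) → ℤ
  ΦT t k = ⟦ substTL σ t ⟧ k

  Φ-cong : (P : Forest (Fin n)) {h k : Forest B → ℤ} → (∀ x → h x ≡ k x) → Φ P h ≡ Φ P k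
  Φ-cong P e = ⟦⟧-cong (substFL σ P) e

  ΦT-cong : (t : Tree (Fin n)) {h k : Forest B → ℤ} → (∀ x → h x ≡ k x) → ΦT t h ≡ ΦT t k
  ΦT-cong t e = ⟦⟧-cong (substTL σ t) e

  ΦT-node : (a : Fin n) (cs : Forest (Fin n)) (k : Forest B → ℤ) → ΦT (node a cs) k ≡ ⟦ σ a ⟧ (λ f → Φ cs (λ F → ∑attach f F k))
  ΦT-node a cs k = trans (⟦⟧-bilin (λ f F → basis (attachF f F)) (σ a) (substFL σ cs) k)
    (⟦⟧-cong (σ a) (λ f → ⟦⟧-cong (substFL σ cs) (λ F → ⟦⟧-basis (attachF f F) k)))

  Φ-∷ : (t : Tree (Fin n)) (ts : Forest (Fin n)) (k : Forest B → ℤ) → Φ (t ∷ ts) k ≡ ΦT t (λ x → Φ ts (λ y → k (x ++ y)))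
  Φ-∷ t ts k = ⟦⟧-concatL (substTL σ t) (substFL σ ts) k

  Φ-[] : (k : Forest B → ℤ) → Φ [] k ≡ k []
  Φ-[] k = ⟦⟧-single [] k

  Φ-++ : (P Q : Forest (Fin n)) (k : Forest B → ℤ) → Φ (P ++ Q) k ≡ Φ P (λ x → Φ Q (λ y → k (x ++ y)))
  Φ-++ [] Q k = sym (Φ-[] (λ x → Φ Q (λ y → k (x ++ y))))
  Φ-++ (t ∷ P) Q k = begin
      Φ (t ∷ (P ++ Q)) k
    ≡⟨ Φ-∷ t (P ++ Q) k ⟩
      ΦT t (λ x → Φ (P ++ Q) (λ y → k (x ++ y)))
    ≡⟨ ΦT-cong t (λ x → trans (Φ-++ P Q (λ y → k (x ++ y)))
          (Φ-cong P (λ y1 → Φ-cong Q (λ y2 → cong k (sym (++-assoc x y1 y2)))))) ⟩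
      ΦT t (λ x → Φ P (λ y1 → Φ Q (λ y2 → k ((x ++ y1) ++ y2))))
    ≡⟨ sym (Φ-∷ t P (λ z → Φ Q (λ y → k (z ++ y)))) ⟩
      Φ (t ∷ P) (λ x → Φ Q (λ y → k (x ++ y))) ∎

  ignoresEmpty-substTL : (t : Tree (Fin n)) → IgnoresEmpty (substTL σ t)
  ignoresEmpty-substTL (node a cs) k1 k2 e = trans (ΦT-node a cs k1) (trans (σ-ignoresEmpty a _ _ (λ u us → Φ-cong cs (λ F →
      trans (∑attach-∷ u us F k1) (trans (Δ-cong F (λ p q → ∑attachT-cong u p (λ t' → ∑attach-cong us q (λ r → e t' r))))
        (sym (∑attach-∷ u us F k2)))))) (sym (ΦT-node a cs k2)))

  primitive-substTL : (t : Tree (Fin n)) → Primitive (substTL σ t)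
  primitive-substTL (node a cs) H = begin
      ΦT (node a cs) (λ x → Δ x H)
    ≡⟨ ΦT-node a cs _ ⟩
      ⟦ σ a ⟧ (λ f → Φ cs (λ F → ∑attach f F (λ x → Δ x H)))
    ≡⟨ ⟦⟧-cong (σ a) (λ f → trans (Φ-cong cs (λ F → ∑attach-Δ f F H)) (⟦⟧-Δ (substFL σ cs) f _)) ⟩
      ⟦ σ a ⟧ (λ f → Δ f (λ f1 f2 → K f1 f2))
    ≡⟨ σ-primitive a K ⟩
      ⟦ σ a ⟧ (λ f → K f [] + K [] f)
    ≡⟨ ⟦⟧-cong (σ a) (λ f → cong₂ _+_
          (Φ-cong cs (λ F → trans (Δ-cong F (λ F₁ F₂ → ∑-comm (attachF f F₁) (attachF [] F₂) _))
                                   (Δ-∑attach-[]ʳ F (λ F₁ x2 → ∑attach f F₁ (λ x1 → H x1 x2)))))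
          (Φ-cong cs (λ F → Δ-∑attach-[]ˡ F (λ x1 F₂ → ∑attach f F₂ (λ x2 → H x1 x2))))) ⟩
      ⟦ σ a ⟧ (λ f → Φ cs (λ F → ∑attach f F (λ x → H x [])) + Φ cs (λ F → ∑attach f F (λ x → H [] x)))
    ≡⟨ ⟦⟧-cong (σ a) (λ f → trans (sym (⟦⟧-+ (substFL σ cs) _ _)) (Φ-cong cs (λ F → sym (∑-+ (attachF f F) _ _)))) ⟩
      ⟦ σ a ⟧ (λ f → Φ cs (λ F → ∑attach f F (λ x → H x [] + H [] x)))
    ≡⟨ sym (ΦT-node a cs _) ⟩
      ΦT (node a cs) (λ x → H x [] + H [] x) ∎
    where
      K : Forest B → Forest B → ℤ
      K f1 f2 = Φ cs (λ F → Δ F (λ F₁ F₂ → ∑attach f1 F₁ (λ x1 → ∑attach f2 F₂ (λ x2 → H x1 x2))))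

  Φ-Δ : (P : Forest (Fin n)) (H : Forest B → Forest B → ℤ) →
    Φ P (λ F → Δ F H) ≡ Δ P (λ p q → Φ p (λ F₁ → Φ q (λ F₂ → H F₁ F₂)))
  Φ-Δ [] H = trans (Φ-[] (λ F → Δ F H)) (trans (Δ-[] H) (sym (trans (Δ-[] (λ p q → Φ p (λ F₁ → Φ q (λ F₂ → H F₁ F₂)))) (trans (Φ-[] (λ F₁ → Φ [] (λ F₂ → H F₁ F₂))) (Φ-[] (λ F₂ → H [] F₂))))))
  Φ-Δ (t ∷ P) H = begin
      Φ (t ∷ P) (λ F → Δ F H)
    ≡⟨ Φ-∷ t P _ ⟩
      ΦT t (λ x → Φ P (λ y → Δ (x ++ y) H))
    ≡⟨ ΦT-cong t (λ x → trans (Φ-cong P (λ y → Δ-++ x y H)) (⟦⟧-Δ (substFL σ P) x _)) ⟩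
      ΦT t (λ x → Δ x (λ x1 x2 → K x1 x2))
    ≡⟨ primitive-substTL t K ⟩
      ΦT t (λ x → K x [] + K [] x)
    ≡⟨ ΦT-cong t (λ x → cong₂ _+_ (Φ-Δ P (λ y1 y2 → H (x ++ y1) y2)) (Φ-Δ P (λ y1 y2 → H y1 (x ++ y2)))) ⟩
      ΦT t (λ x → Δ P (λ p q → Φ p (λ y1 → Φ q (λ y2 → H (x ++ y1) y2)))
                 + Δ P (λ p q → Φ p (λ y1 → Φ q (λ y2 → H y1 (x ++ y2)))))
    ≡⟨ trans (⟦⟧-+ (substTL σ t) _ _) (cong₂ _+_ (⟦⟧-Δ (substTL σ t) P _) (⟦⟧-Δ (substTL σ t) P _)) ⟩
      Δ P (λ p q → ΦT t (λ x → Φ p (λ y1 → Φ q (λ y2 → H (x ++ y1) y2))))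
        + Δ P (λ p q → ΦT t (λ x → Φ p (λ y1 → Φ q (λ y2 → H y1 (x ++ y2)))))
    ≡⟨ sym (Δ-+ P _ _) ⟩
      Δ P (λ p q → ΦT t (λ x → Φ p (λ y1 → Φ q (λ y2 → H (x ++ y1) y2)))
                  + ΦT t (λ x → Φ p (λ y1 → Φ q (λ y2 → H y1 (x ++ y2)))))
    ≡⟨ Δ-cong P (λ p q → cong₂ _+_ (sym (Φ-∷ t p (λ F₁ → Φ q (λ F₂ → H F₁ F₂))))
          (trans (⟦⟧-comm (substTL σ t) (substFL σ p) _) (Φ-cong p (λ F₁ → sym (Φ-∷ t q (λ F₂ → H F₁ F₂)))))) ⟩
      Δ P (λ p q → Φ (t ∷ p) (λ F₁ → Φ q (λ F₂ → H F₁ F₂)) + Φ p (λ F₁ → Φ (t ∷ q) (λ F₂ → H F₁ F₂)))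
    ≡⟨ sym (Δ-∷ t P _) ⟩
      Δ (t ∷ P) (λ p q → Φ p (λ F₁ → Φ q (λ F₂ → H F₁ F₂))) ∎
    where
      K : Forest B → Forest B → ℤ
      K x1 x2 = Φ P (λ y → Δ y (λ y1 y2 → H (x1 ++ y1) (x2 ++ y2)))

  -- Primitivity of the σ i enters here, through Φ-Δ.
  mutual
    ∑attach-Φ : (G : Forest (Fin n)) (P : List (Tree (Fin n))) (k : Forest B → ℤ) →
      ∑attach G P (λ r → Φ r k) ≡ Φ P (λ F → Φ G (λ g → ∑attach g F k))
    ∑attach-Φ [] [] k = trans (∑attach-[]-[] (λ r → Φ r k)) (trans (Φ-[] k) (sym (trans (Φ-[] (λ F → Φ [] (λ g → ∑attach g F k)))
                    (trans (Φ-[] (λ g → ∑attach g [] k)) (∑attach-[]-[] k)))))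
    ∑attach-Φ [] (τ ∷ P') k = sym (trans (Φ-∷ τ P' _) (trans (ignoresEmpty-substTL τ _ (λ _ → 0ℤ)
        (λ u us → trans (Φ-cong P' (λ y → Φ-[] (λ g → ∑attach g (u ∷ us ++ y) k))) (⟦⟧-zero (substFL σ P'))))
        (⟦⟧-zero (substTL σ τ))))
    ∑attach-Φ (g ∷ gs) P k = begin
        ∑attach (g ∷ gs) P (λ r → Φ r k)
      ≡⟨ ∑attach-∷ g gs P _ ⟩
        Δ P (λ a b → ∑attachT g a (λ t' → ∑attach gs b (λ r → Φ (t' ∷ r) k)))
      ≡⟨ Δ-cong P (λ a b → ∑attachT-cong g a (λ t' → trans (∑attach-cong gs b (λ r → Φ-∷ t' r k))
            (sym (⟦⟧-∑ (substTL σ t') (attachF gs b) (λ x r → Φ r (λ y → k (x ++ y))))))) ⟩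
        Δ P (λ a b → ∑attachT g a (λ t' → ΦT t' (λ x → ∑attach gs b (λ r → Φ r (λ y → k (x ++ y))))))
      ≡⟨ Δ-cong P (λ a b → trans (∑attachT-cong g a (λ t' → ΦT-cong t' (λ x → ∑attach-Φ gs b (λ y → k (x ++ y)))))
            (∑attachT-ΦT g a (λ x → Φ b (λ F₂ → Φ gs (λ g2 → ∑attach g2 F₂ (λ y → k (x ++ y))))))) ⟩
        Δ P (λ a b → Φ a (λ F₁ → ΦT g (λ g1 → ∑attach g1 F₁ (λ x → Φ b (λ F₂ → Φ gs (λ g2 → ∑attach g2 F₂ (λ y → k (x ++ y))))))))
      ≡⟨ Δ-cong P (λ a b → Φ-cong a (λ F₁ → trans (ΦT-cong g (λ g1 →
            trans (sym (⟦⟧-∑ (substFL σ b) (attachF g1 F₁) _)) (Φ-cong b (λ F₂ → sym (⟦⟧-∑ (substFL σ gs) (attachF g1 F₁) _)))))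
            (⟦⟧-comm (substTL σ g) (substFL σ b) _))) ⟩
        Δ P (λ a b → Φ a (λ F₁ → Φ b (λ F₂ → ΦT g (λ g1 → Φ gs (λ g2 → ∑attach g1 F₁ (λ x → ∑attach g2 F₂ (λ y → k (x ++ y))))))))
      ≡⟨ sym (Φ-Δ P _) ⟩
        Φ P (λ F → Δ F (λ F₁ F₂ → ΦT g (λ g1 → Φ gs (λ g2 → ∑attach g1 F₁ (λ x → ∑attach g2 F₂ (λ y → k (x ++ y)))))))
      ≡⟨ Φ-cong P (λ F → sym (trans (ΦT-cong g (λ g1 → ⟦⟧-Δ (substFL σ gs) F _)) (⟦⟧-Δ (substTL σ g) F _))) ⟩
        Φ P (λ F → ΦT g (λ g1 → Φ gs (λ g2 → Δ F (λ F₁ F₂ → ∑attach g1 F₁ (λ x → ∑attach g2 F₂ (λ y → k (x ++ y)))))))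
      ≡⟨ Φ-cong P (λ F → trans (ΦT-cong g (λ g1 → Φ-cong gs (λ g2 → sym (∑attach-++ g1 g2 F k)))) (sym (Φ-∷ g gs (λ g' → ∑attach g' F k)))) ⟩
        Φ P (λ F → Φ (g ∷ gs) (λ g' → ∑attach g' F k)) ∎

    ∑attachT-ΦT : (t : Tree (Fin n)) (P : List (Tree (Fin n))) (k : Forest B → ℤ) →
      ∑attachT t P (λ r → ΦT r k) ≡ Φ P (λ F → ΦT t (λ g → ∑attach g F k))
    ∑attachT-ΦT (node c cs) P k = begin
        ∑attachT (node c cs) P (λ r → ΦT r k)
      ≡⟨ ∑attachT-node c cs P _ ⟩
        Δ P (λ p q → ∑attach cs q (λ X → ΦT (node c (p ++ X)) k))
      ≡⟨ Δ-cong P (λ p q → ∑attach-cong cs q (λ X → trans (ΦT-node c (p ++ X) k) (⟦⟧-cong (σ c) (λ f → Φ-++ p X _)))) ⟩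
        Δ P (λ p q → ∑attach cs q (λ X → ⟦ σ c ⟧ (λ f → Φ p (λ F₁ → Φ X (λ F₂ → ∑attach f (F₁ ++ F₂) k)))))
      ≡⟨ Δ-cong P (λ p q → trans (sym (⟦⟧-∑ (σ c) (attachF cs q) _)) (⟦⟧-cong (σ c) (λ f → sym (⟦⟧-∑ (substFL σ p) (attachF cs q) _)))) ⟩
        Δ P (λ p q → ⟦ σ c ⟧ (λ f → Φ p (λ F₁ → ∑attach cs q (λ X → Φ X (λ F₂ → ∑attach f (F₁ ++ F₂) k)))))
      ≡⟨ Δ-cong P (λ p q → ⟦⟧-cong (σ c) (λ f → Φ-cong p (λ F₁ → ∑attach-Φ cs q (λ F₂ → ∑attach f (F₁ ++ F₂) k)))) ⟩
        Δ P (λ p q → ⟦ σ c ⟧ (λ f → Φ p (λ F₁ → Φ q (λ Y → W f F₁ Y))))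
      ≡⟨ Δ-cong P (λ p q → trans (⟦⟧-comm (σ c) (substFL σ p) _) (Φ-cong p (λ F₁ → ⟦⟧-comm (σ c) (substFL σ q) _))) ⟩
        Δ P (λ p q → Φ p (λ F₁ → Φ q (λ F₂ → ⟦ σ c ⟧ (λ f → W f F₁ F₂))))
      ≡⟨ sym (Φ-Δ P _) ⟩
        Φ P (λ F → Δ F (λ F₁ F₂ → ⟦ σ c ⟧ (λ f → W f F₁ F₂)))
      ≡⟨ Φ-cong P (λ F → sym (trans (⟦⟧-cong (σ c) (λ f → trans (Φ-cong cs (λ G → ∑attach-assoc f G F k)) (⟦⟧-Δ (substFL σ cs) F _)))
            (⟦⟧-Δ (σ c) F _))) ⟩
        Φ P (λ F → ⟦ σ c ⟧ (λ f → Φ cs (λ G → ∑attach f G (λ g → ∑attach g F k))))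
      ≡⟨ Φ-cong P (λ F → sym (ΦT-node c cs (λ g → ∑attach g F k))) ⟩
        Φ P (λ F → ΦT (node c cs) (λ g → ∑attach g F k)) ∎
      where
        W : Forest B → List (Tree B) → List (Tree B) → ℤ
        W f F₁ Y = Φ cs (λ g → ∑attach g Y (λ F₂ → ∑attach f (F₁ ++ F₂) k))

  Φ-vertex : (i : Fin n) (h : Forest B → ℤ) → Φ (node i [] ∷ []) h ≡ ⟦ σ i ⟧ h
  Φ-vertex i h = begin
      Φ (node i [] ∷ []) h
    ≡⟨ Φ-∷ (node i []) [] h ⟩
      ΦT (node i []) (λ x → Φ [] (λ y → h (x ++ y)))
    ≡⟨ ΦT-node i [] _ ⟩
      ⟦ σ i ⟧ (λ f → Φ [] (λ F → ∑attach f F (λ x → Φ [] (λ y → h (x ++ y)))))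
    ≡⟨ ⟦⟧-cong (σ i) (λ f → trans (Φ-[] (λ F → ∑attach f F (λ x → Φ [] (λ y → h (x ++ y)))))
          (trans (∑attach-[]ʳ f (λ x → Φ [] (λ y → h (x ++ y)))) (trans (Φ-[] (λ y → h (f ++ y))) (cong h (++-identityʳ f))))) ⟩
      ⟦ σ i ⟧ h ∎

  ⟦evalM⟧ : (m : Mono n) (h : Forest B → ℤ) → ⟦ evalM σ m ⟧ h ≡ ⟦ evalM vertex m ⟧ (λ w → Φ w h)
  ⟦evalM⟧ (leaf i) h = sym (trans (⟦⟧-single (node i [] ∷ []) (λ w → Φ w h)) (Φ-vertex i h))
  ⟦evalM⟧ (cat a b) h = begin
      ⟦ concatL (evalM σ a) (evalM σ b) ⟧ h
    ≡⟨ ⟦⟧-concatL (evalM σ a) (evalM σ b) h ⟩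
      ⟦ evalM σ a ⟧ (λ x → ⟦ evalM σ b ⟧ (λ y → h (x ++ y)))
    ≡⟨ ⟦⟧-cong (evalM σ a) (λ x → ⟦evalM⟧ b (λ y → h (x ++ y))) ⟩
      ⟦ evalM σ a ⟧ (λ x → ⟦ b′ ⟧ (λ w′ → Φ w′ (λ y → h (x ++ y))))
    ≡⟨ ⟦evalM⟧ a _ ⟩
      ⟦ a′ ⟧ (λ w → Φ w (λ x → ⟦ b′ ⟧ (λ w′ → Φ w′ (λ y → h (x ++ y)))))
    ≡⟨ ⟦⟧-cong a′ (λ w → trans (⟦⟧-comm (substFL σ w) b′ _) (⟦⟧-cong b′ (λ w′ → sym (Φ-++ w w′ h)))) ⟩
      ⟦ a′ ⟧ (λ w → ⟦ b′ ⟧ (λ w′ → Φ (w ++ w′) h))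
    ≡⟨ sym (⟦⟧-concatL a′ b′ (λ w → Φ w h)) ⟩
      ⟦ concatL a′ b′ ⟧ (λ w → Φ w h) ∎
    where a′ = evalM vertex a
          b′ = evalM vertex b
  ⟦evalM⟧ (grf a b) h = begin
      ⟦ bilin _▷_ (evalM σ a) (evalM σ b) ⟧ h
    ≡⟨ trans (⟦⟧-bilin _▷_ (evalM σ a) (evalM σ b) h) (⟦⟧-cong (evalM σ a) (λ x → ⟦⟧-cong (evalM σ b) (λ y → ⟦▷⟧ x y h))) ⟩
      ⟦ evalM σ a ⟧ (λ x → ⟦ evalM σ b ⟧ (λ y → ∑attach y x h))
    ≡⟨ ⟦⟧-cong (evalM σ a) (λ x → ⟦evalM⟧ b (λ y → ∑attach y x h)) ⟩
      ⟦ evalM σ a ⟧ (λ x → ⟦ b′ ⟧ (λ w′ → Φ w′ (λ y → ∑attach y x h)))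
    ≡⟨ ⟦evalM⟧ a _ ⟩
      ⟦ a′ ⟧ (λ w → Φ w (λ x → ⟦ b′ ⟧ (λ w′ → Φ w′ (λ y → ∑attach y x h))))
    ≡⟨ ⟦⟧-cong a′ (λ w → trans (⟦⟧-comm (substFL σ w) b′ _)
          (⟦⟧-cong b′ (λ w′ → trans (sym (∑attach-Φ w′ w h)) (sym (⟦▷⟧ w w′ (λ r → Φ r h)))))) ⟩
      ⟦ a′ ⟧ (λ w → ⟦ b′ ⟧ (λ w′ → ⟦ w ▷ w′ ⟧ (λ r → Φ r h)))
    ≡⟨ sym (⟦⟧-bilin _▷_ a′ b′ (λ r → Φ r h)) ⟩
      ⟦ bilin _▷_ a′ b′ ⟧ (λ w → Φ w h) ∎
    where a′ = evalM vertex a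
          b′ = evalM vertex b

  ⟦evalE⟧ : (E : Lin (Mono n)) (ω : Forest (Fin n)) → LinEq _≟F_ (evalE vertex E) ((1ℤ , ω) ∷ []) →
    (h : Forest B → ℤ) → ⟦ evalE σ E ⟧ h ≡ Φ ω h
  ⟦evalE⟧ E ω E≡ω h = begin
      ⟦ evalE σ E ⟧ h
    ≡⟨ ⟦⟧-linmap (evalM σ) E h ⟩
      ⟦ E ⟧ (λ m → ⟦ evalM σ m ⟧ h)
    ≡⟨ ⟦⟧-cong E (λ m → ⟦evalM⟧ m h) ⟩
      ⟦ E ⟧ (λ m → ⟦ evalM vertex m ⟧ (λ w → Φ w h))
    ≡⟨ sym (⟦⟧-linmap (evalM vertex) E _) ⟩
      ⟦ evalE vertex E ⟧ (λ w → Φ w h)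
    ≡⟨ LinEq⇒⟦⟧≡ (decForest _≟F_) (evalE vertex E) ((1ℤ , ω) ∷ []) E≡ω _ ⟩
      ⟦ (1ℤ , ω) ∷ [] ⟧ (λ w → Φ w h)
    ≡⟨ ⟦⟧-single ω (λ w → Φ w h) ⟩
      Φ ω h ∎

mainTheorem10 : (n : ℕ) (ω : Forest (Fin n)) → labelsF ω ↭ allFin n →
    (lie : Fin n → Lin (LieTerm ℕ)) → ((i : Fin n) → All (λ p → StdLabelled (proj₂ p)) (lie i)) →
    (E : Lin (Mono n)) → All (λ p → leaves (proj₂ p) ↭ allFin n) E →
    LinEq _≟F_ (evalE vertex E) ((1ℤ , ω) ∷ []) →
    LinEq (≡-dec _≟F_ _≟ℕ_)
      (evalE (λ i → relabelL (i ,_) (interpL (lie i))) E)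
      (substFL (λ i → relabelL (i ,_) (interpL (lie i))) ω)
mainTheorem10 n ω _ lie _ E _ E≡ω =
  ⟦⟧≡⇒LinEq (decForest (≡-dec _≟F_ _≟ℕ_)) (evalE σ E) (substFL σ ω) (⟦evalE⟧ E ω E≡ω)
  where
    σ : Fin n → Lin (Forest (Fin n × ℕ))
    σ i = relabelL (i ,_) (interpL (lie i))

    open Substitution σ
      (λ i → primitive-relabelL (i ,_) (interpL (lie i)) (primitive-interpL (lie i)))
      (λ i → ignoresEmpty-relabelL (i ,_) (interpL (lie i)) (ignoresEmpty-interpL (lie i)))
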